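{- Let $q\equiv 3\pmod 4$ be an odd prime power. Then $(\mathbb F_q,\operatorname{Dev}D_0^2\cup\operatorname{Dev}D_1^2)$ is a $3$-$(q,\frac{q-1}{2},\frac{q-7}{4})$ adesign.
   Context: $D_0^2$ is the set of nonzero squares in $\mathbb F_q$ and $D_1^2$ the set of non-squares. $\operatorname{Dev}C=\{C+g\mid g\in\mathbb F_q\}$; the union is a collection of $2q$ blocks. A $t$-$(v,k,\lambda)$ adesign is an incidence structure with $v$ points and blocks of size $k$ such that every $t$-subset of points lies in exactly $\lambda$ or exactly $\lambda+1$ blocks, both values occurring. -}

module Defs where

open import Data.Nat using (ℕ; zero; suc; _+_; _*_)
open import Data.Bool using (Bool; true; false; _∧_)
open import Data.Fin using (Fin)
import Data.Fin as Fin
open import Data.Fin.Properties using (any?)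
open import Data.List using (List; length; filter; map; _++_; allFin)
open import Data.Bool.ListAction using (and)
open import Data.List.Membership.Propositional using (_∈_)
open import Data.Sum using (_⊎_)
open import Data.Product using (Σ; ∃; _×_; _,_)
open import Function.Bundles using (_↔_; Inverse)
open import Function.Definitions using (Injective)
open import Relation.Nullary using (¬_; Dec; does; yes; no)
open import Relation.Nullary.Decidable using (¬?; _×-dec_)
open import Relation.Binary.PropositionalEquality using (_≡_; refl; _≢_; sym; trans; cong)
open import Algebra.Structures using (IsCommutativeRing)

record IncidenceStructure : Set₁ where
  field
    Point  : Set
    v      : ℕ
    points : Fin v ↔ Point
    blocks : List (Point → Bool)    -- a list = a multiset of blocks

  pointList : List Point
  pointList = map (Inverse.to points) (allFin v)

  blockSize : (Point → Bool) → ℕ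
  blockSize B = length (filter (λ x → B x ≟b true) pointList)
    where
      _≟b_ : (a b : Bool) → Dec (a ≡ b)
      _≟b_ = Data.Bool._≟_

  blocksContaining : ∀ {t} → (Fin t → Point) → ℕ
  blocksContaining {t} S =
    length (filter (λ B → and (map (λ j → B (S j)) (allFin t)) Data.Bool.≟ true) blocks)

open IncidenceStructure public

-- A t-subset of points is represented by an injective map Fin t → Point.
-- t-(v,k,λ) adesign: v points, all blocks of size k, every t-subset lies in
-- exactly λ or λ+1 blocks, and both values occur.
record IsAdesign (D : IncidenceStructure) (t v k lam : ℕ) : Set where
  field
    numPoints  : IncidenceStructure.v D ≡ v
    blockSizes : ∀ B → B ∈ blocks D → blockSize D B ≡ k
    eitherVal  : (S : Fin t → Point D) → Injective _≡_ _≡_ S →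
                 (blocksContaining D S ≡ lam) ⊎ (blocksContaining D S ≡ suc lam)
    λOccurs    : Σ (Fin t → Point D) λ S → Injective _≡_ _≡_ S × blocksContaining D S ≡ lam
    λ+1Occurs  : Σ (Fin t → Point D) λ S → Injective _≡_ _≡_ S × blocksContaining D S ≡ suc lam

record FiniteField (q : ℕ) : Set₁ where
  field
    Carrier : Set
    _+F_    : Carrier → Carrier → Carrier
    _*F_    : Carrier → Carrier → Carrier
    -F_     : Carrier → Carrier
    0F      : Carrier
    1F      : Carrier
    isCommutativeRing : IsCommutativeRing _≡_ _+F_ _*F_ -F_ 0F 1F
    0≢1     : 0F ≢ 1F
    inverse : ∀ x → x ≢ 0F → ∃ λ y → x *F y ≡ 1F
    enum    : Fin q ↔ Carrier

  _-F_ : Carrier → Carrier → Carrier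
  x -F y = x +F (-F y)

  elements : List Carrier
  elements = map (Inverse.to enum) (allFin q)

  _≟F_ : (x y : Carrier) → Dec (x ≡ y)
  x ≟F y with Inverse.from enum x Fin.≟ Inverse.from enum y
  ... | yes p = yes (trans (sym (Inverse.strictlyInverseˡ enum x))
                     (trans (cong (Inverse.to enum) p) (Inverse.strictlyInverseˡ enum y)))
  ... | no ¬p = no λ e → ¬p (cong (Inverse.from enum) e)

  IsSquare : Carrier → Set
  IsSquare x = ∃ λ y → y *F y ≡ x

  isSquare? : ∀ x → Dec (IsSquare x)
  isSquare? x with any? (λ i → (Inverse.to enum i *F Inverse.to enum i) ≟F x)
  ... | yes (i , e) = yes (Inverse.to enum i , e)
  ... | no ¬e = no λ { (y , e) → ¬e (Inverse.from enum y ,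
          trans (cong (λ z → z *F z) (Inverse.strictlyInverseˡ enum y)) e) }

  -- D_0^2 : nonzero squares;  D_1^2 : non-squares (nonzero non-squares)
  InD0 : Carrier → Set
  InD0 x = ¬ (x ≡ 0F) × IsSquare x

  InD1 : Carrier → Set
  InD1 x = ¬ (x ≡ 0F) × ¬ IsSquare x

  inD0 : Carrier → Bool
  inD0 x = does (¬? (x ≟F 0F) ×-dec isSquare? x)

  inD1 : Carrier → Bool
  inD1 x = does (¬? (x ≟F 0F) ×-dec ¬? (isSquare? x))

  translate : (Carrier → Bool) → Carrier → (Carrier → Bool)
  translate C g y = C (y -F g)

  Dev : (Carrier → Bool) → List (Carrier → Bool)
  Dev C = map (translate C) elements

  cyclotomicDesign : IncidenceStructure
  cyclotomicDesign = record
    { Point  = Carrier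
    ; v      = q
    ; points = enum
    ; blocks = Dev inD0 ++ Dev inD1
    }

-- Let χ be the quadratic character of F_q.  For g outside a 3-set {a, b, c}, a translate
-- D₀² + g or D₁² + g contains a, b, c iff χ (a - g), χ (b - g), χ (c - g) are equal, i.e. iff
-- 1 + χ(a-g)χ(b-g) + χ(b-g)χ(c-g) + χ(a-g)χ(c-g) is 4 rather than 0.  Summing over g with the
-- Jacobi sums ∑_g χ(a-g)χ(b-g) = -1 gives 4N + 3 + T = q - 3 for the number N of blocks through
-- a, b, c, where T = χ(b-a)χ(c-a) + χ(a-b)χ(c-b) + χ(a-c)χ(b-c).  For q ≡ 3 (mod 4), -1 is a
-- non-square, so χ is odd and T = xy - xz + yz with x, y, z = ±1; hence T ∈ {1, -3} and
-- N ∈ {(q - 7)/4, (q - 3)/4}.  Triples {g, 0, 1} realise both values, again by a character sum.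
-- The facts about χ (|D₀²| = |D₁²| = (q - 1)/2, multiplicativity, χ(-1) = -1) come from counting:
-- squaring is two-to-one on F_q^×, and a fixed-point-free involution has a support of even size.

module Submission where

open import Defs
open import Data.Nat using (ℕ; _≤_; _∸_; _/_; _%_)
open import Relation.Binary.PropositionalEquality using (_≡_)

open import Data.Bool using (Bool; true; false; not; _∧_; if_then_else_)
import Data.Bool as Bool
import Data.Bool.Properties as Bool
open import Data.Empty using (⊥-elim)
open import Data.Fin using (Fin; zero; suc)
import Data.Fin as Fin
import Data.Fin.Properties as Fin
open import Data.Integer using (ℤ; +_; -[1+_]; _+_; _*_; -_; _-_; 0ℤ; 1ℤ; -1ℤ)
import Data.Integer as ℤ
import Data.Integer.Properties as ℤ
open import Data.List using (_++_; filter; length; map; tabulate)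
open import Data.List.Properties using (map-∘; map-tabulate; map-id; filter-++; length-++)
open import Data.List.Membership.Propositional using (_∈_)
open import Data.List.Membership.Propositional.Properties using (∈-++⁻; ∈-map⁻)
open import Data.Maybe using (Maybe; just; nothing)
open import Data.Nat.DivMod using (m≡m%n+[m/n]*n; m*n/n≡m)
import Data.Nat as ℕ
import Data.Nat.Properties as ℕ
open import Data.Product using (Σ; ∃; _×_; _,_; proj₁; proj₂)
open import Data.Sum using (_⊎_; inj₁; inj₂; [_,_]′)
import Data.Sum as Sum
open import Function using (_∘_; case_of_)
open import Function.Definitions using (Injective)
open import Relation.Nullary using (¬_; Dec; does; proof; yes; no)
open import Relation.Nullary.Decidable using (¬?; _×-dec_; dec-true; dec-false; does-⇔)
open import Relation.Binary.Definitions using (tri<; tri≈; tri>)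
open import Function.Bundles using (_⇔_; mk⇔)
open import Relation.Nullary.Reflects using (invert)
open import Relation.Binary.PropositionalEquality
  using (_≡_; _≢_; refl; sym; trans; cong; cong₂; subst; subst₂; ≢-sym; module ≡-Reasoning)
open import Algebra.Bundles using (CommutativeRing)
import Algebra.Solver.Ring.AlmostCommutativeRing as ACR
import Algebra.Solver.Ring
import Algebra.Properties.Ring
import Algebra.Properties.Semiring.Mult
open import Algebra.Properties.Semiring.Sum ℤ.+-*-semiring
  using (sum; sum-cong-≗; sum-replicate-zero; *-distribˡ-sum; ∑-distrib-+; ∑-permute)
  renaming (∑-comm to sum-comm)
open import Data.Fin.Permutation using (Permutation; permutation)
open import Algebra.Properties.AbelianGroup ℤ.+-0-abelianGroup using (∙-cancelˡ; ∙-cancelʳ)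
open import Data.Nat.Tactic.RingSolver using () renaming (solve-∀ to ℕ-solve-∀)
open import Data.Integer.Tactic.RingSolver using (solve-∀)

-- Integer sums over Fin n

[_] : Bool → ℤ
[ true ] = 1ℤ
[ false ] = 0ℤ

sum-const : ∀ n c → sum {n} (λ _ → c) ≡ + n * c
sum-const ℕ.zero c = refl
sum-const (ℕ.suc n) c = begin
  c + sum {n} (λ _ → c)  ≡⟨ cong (_+_ c) (sum-const n c) ⟩
  c + + n * c            ≡⟨ cong (_+ + n * c) (sym (ℤ.*-identityˡ c)) ⟩
  1ℤ * c + + n * c       ≡⟨ sym (ℤ.*-distribʳ-+ c 1ℤ (+ n)) ⟩
  + ℕ.suc n * c          ∎
  where open ≡-Reasoning

sum-neg : ∀ {n} (f : Fin n → ℤ) → sum (λ i → - f i) ≡ - sum f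
sum-neg f = begin
  sum (λ i → - f i)      ≡⟨ sum-cong-≗ (λ i → sym (ℤ.-1*i≡-i (f i))) ⟩
  sum (λ i → -1ℤ * f i)  ≡⟨ sym (*-distribˡ-sum -1ℤ f) ⟩
  -1ℤ * sum f            ≡⟨ ℤ.-1*i≡-i (sum f) ⟩
  - sum f                ∎
  where open ≡-Reasoning

sum-pick : ∀ {n} (f : Fin n → ℤ) j → sum (λ i → [ does (i Fin.≟ j) ] * f i) ≡ f j
sum-pick {ℕ.suc n} f zero = begin
  1ℤ * f zero + sum {n} (λ _ → 0ℤ) ≡⟨ cong₂ _+_ (ℤ.*-identityˡ (f zero)) (sum-replicate-zero n) ⟩
  f zero + 0ℤ                      ≡⟨ ℤ.+-identityʳ (f zero) ⟩
  f zero                           ∎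
  where open ≡-Reasoning
sum-pick {ℕ.suc n} f (suc j) = trans (ℤ.+-identityˡ _) (sum-pick (f ∘ suc) j)

sum-witness : ∀ {n} (f : Fin n → ℤ) → sum f ≢ 0ℤ → ∃ λ i → f i ≢ 0ℤ
sum-witness {ℕ.zero} f sum≢0 = ⊥-elim (sum≢0 refl)
sum-witness {ℕ.suc n} f sum≢0 with f zero ℤ.≟ 0ℤ
... | no f0≢0 = zero , f0≢0
... | yes f0≡0 with sum-witness (f ∘ suc) (λ e → sum≢0 (cong₂ _+_ f0≡0 e))
...   | i , fi≢0 = suc i , fi≢0

length-filter-tabulate : ∀ {A : Set} {n} (b : A → Bool) (f : Fin n → A) →
  + length (filter (λ x → b x Bool.≟ true) (tabulate f)) ≡ sum (λ i → [ b (f i) ])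
length-filter-tabulate {n = ℕ.zero} b f = refl
length-filter-tabulate {n = ℕ.suc n} b f with b (f zero)
... | true = trans (ℤ.pos-+ 1 _) (cong (_+_ 1ℤ) (length-filter-tabulate b (f ∘ suc)))
... | false = trans (length-filter-tabulate b (f ∘ suc)) (sym (ℤ.+-identityˡ _))

sum-[]≡0 : ∀ {n} (b : Fin n → Bool) → sum (λ i → [ b i ]) ≡ 0ℤ → ∀ i → b i ≡ false
sum-[]≡0 {ℕ.suc n} b sum≡0 = by-head (b zero) refl sum≡0
  where
  by-head : ∀ h → b zero ≡ h → [ h ] + sum (λ i → [ b (suc i) ]) ≡ 0ℤ → ∀ i → b i ≡ false
  by-head true _ e _ with () ← trans (cong (_+_ 1ℤ) (length-filter-tabulate (λ x → x) (b ∘ suc))) e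
  by-head false b0≡false _ zero = b0≡false
  by-head false _ e (suc i) = sum-[]≡0 (b ∘ suc) (trans (sym (ℤ.+-identityˡ _)) e) i

sum-[]-⊆-equal : ∀ {n} (P Q : Fin n → Bool) → (∀ i → P i ≡ true → Q i ≡ true) →
  sum (λ i → [ P i ]) ≡ sum (λ i → [ Q i ]) → ∀ i → Q i ≡ true → P i ≡ true
sum-[]-⊆-equal {n} P Q P⊆Q same-size i Qi = P-true (P i) refl (sum-[]≡0 rest rest-empty i)
  where
  rest : Fin n → Bool
  rest j = Q j ∧ not (P j)

  split : ∀ j → [ Q j ] ≡ [ P j ] + [ rest j ]
  split j with P j in Pj
  ... | true rewrite P⊆Q j Pj = refl
  ... | false = sym (trans (ℤ.+-identityˡ _) (cong [_] (Bool.∧-identityʳ (Q j))))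

  rest-empty : sum (λ j → [ rest j ]) ≡ 0ℤ
  rest-empty = ∙-cancelˡ (sum (λ j → [ P j ])) _ _ (begin
    sum (λ j → [ P j ]) + sum (λ j → [ rest j ])  ≡⟨ sym (∑-distrib-+ (λ j → [ P j ]) (λ j → [ rest j ])) ⟩
    sum (λ j → [ P j ] + [ rest j ])              ≡⟨ sum-cong-≗ (λ j → sym (split j)) ⟩
    sum (λ j → [ Q j ])                           ≡⟨ sym same-size ⟩
    sum (λ j → [ P j ])                           ≡⟨ sym (ℤ.+-identityʳ _) ⟩
    sum (λ j → [ P j ]) + 0ℤ                      ∎)
    where open ≡-Reasoning

  P-true : ∀ p → P i ≡ p → rest i ≡ false → P i ≡ true
  P-true true Pi _ = Pi
  P-true false Pi restᵢ≡false rewrite Pi | Qi with () ← restᵢ≡false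

-- Defined so that χ x reduces to sgn (inD0 x) once inD1 x is rewritten to not (inD0 x).
sgn : Bool → ℤ
sgn p = [ p ] - [ not p ]

module FieldSolver {q : ℕ} (F : FiniteField q) where
  open FiniteField F public

  infixl 6 _⊕_ _⊝_
  infixl 7 _⊗_
  infix 8 ⊖_

  _⊕_ : Carrier → Carrier → Carrier
  _⊕_ = _+F_

  _⊗_ : Carrier → Carrier → Carrier
  _⊗_ = _*F_

  ⊖_ : Carrier → Carrier
  ⊖_ = -F_

  _⊝_ : Carrier → Carrier → Carrier
  _⊝_ = _-F_

  commutativeRing : CommutativeRing _ _
  commutativeRing = record { isCommutativeRing = isCommutativeRing }

  open CommutativeRing commutativeRing public
    using (+-assoc; +-comm; +-identityˡ; +-identityʳ; -‿inverseʳ;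
           *-assoc; *-comm; *-identityˡ; *-identityʳ; zeroˡ; zeroʳ; distribˡ)
  open Algebra.Properties.Ring (CommutativeRing.ring commutativeRing) public
    using (-0#≈0#; -‿involutive; -‿+-comm; -‿distribˡ-*; -‿distribʳ-*)
  open Algebra.Properties.Semiring.Mult (CommutativeRing.semiring commutativeRing)
    using (×-homo-+; ×1-homo-*) renaming (_×_ to _·_)

  -- Equality of field elements does not compute, so the solver takes its coefficients in ℤ, mapped into F by ι.
  ι : ℤ → Carrier
  ι (+ n) = n · 1F
  ι -[1+ n ] = ⊖ (ℕ.suc n · 1F)

  private
    open ≡-Reasoning

    ι-neg : ∀ i → ι (- i) ≡ ⊖ ι i
    ι-neg (+ ℕ.zero) = sym -0#≈0#
    ι-neg (+ ℕ.suc n) = refl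
    ι-neg -[1+ n ] = sym (-‿involutive _)

    ι-⊖ : ∀ m n → ι (m ℤ.⊖ n) ≡ m · 1F ⊝ n · 1F
    ι-⊖ m ℕ.zero = begin
      m · 1F         ≡⟨ sym (+-identityʳ _) ⟩
      m · 1F ⊕ 0F    ≡⟨ cong (m · 1F ⊕_) (sym -0#≈0#) ⟩
      m · 1F ⊝ 0F    ∎
    ι-⊖ ℕ.zero (ℕ.suc n) = sym (+-identityˡ _)
    ι-⊖ (ℕ.suc m) (ℕ.suc n) = begin
      ι (ℕ.suc m ℤ.⊖ ℕ.suc n)                  ≡⟨ cong ι (ℤ.[1+m]⊖[1+n]≡m⊖n m n) ⟩
      ι (m ℤ.⊖ n)                              ≡⟨ ι-⊖ m n ⟩
      m · 1F ⊝ n · 1F                        ≡⟨ cong (_⊕ ⊖ (n · 1F)) (sym (+-identityˡ _)) ⟩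
      0F ⊕ m · 1F ⊝ n · 1F                   ≡⟨ cong (λ z → z ⊕ m · 1F ⊝ n · 1F) (sym (-‿inverseʳ 1F)) ⟩
      1F ⊝ 1F ⊕ m · 1F ⊝ n · 1F              ≡⟨ cong (_⊕ ⊖ (n · 1F)) (+-assoc 1F (⊖ 1F) _) ⟩
      1F ⊕ (⊖ 1F ⊕ m · 1F) ⊝ n · 1F          ≡⟨ cong (λ z → 1F ⊕ z ⊝ n · 1F) (+-comm (⊖ 1F) _) ⟩
      1F ⊕ (m · 1F ⊝ 1F) ⊝ n · 1F            ≡⟨ cong (_⊕ ⊖ (n · 1F)) (sym (+-assoc 1F _ _)) ⟩
      1F ⊕ m · 1F ⊝ 1F ⊝ n · 1F              ≡⟨ +-assoc _ (⊖ 1F) _ ⟩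
      1F ⊕ m · 1F ⊕ (⊖ 1F ⊝ n · 1F)          ≡⟨ cong (1F ⊕ m · 1F ⊕_) (-‿+-comm 1F (n · 1F)) ⟩
      ℕ.suc m · 1F ⊝ ℕ.suc n · 1F            ∎

    ι-+ : ∀ i j → ι (i + j) ≡ ι i ⊕ ι j
    ι-+ (+ m) (+ n) = ×-homo-+ 1F m n
    ι-+ (+ m) -[1+ n ] = ι-⊖ m (ℕ.suc n)
    ι-+ -[1+ m ] (+ n) = trans (ι-⊖ n (ℕ.suc m)) (+-comm _ _)
    ι-+ -[1+ m ] -[1+ n ] = begin
      ⊖ (ℕ.suc (ℕ.suc (m ℕ.+ n)) · 1F)                 ≡⟨ cong (λ z → ⊖ (ℕ.suc z · 1F)) (sym (ℕ.+-suc m n)) ⟩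
      ⊖ ((ℕ.suc m ℕ.+ ℕ.suc n) · 1F)                   ≡⟨ cong ⊖_ (×-homo-+ 1F (ℕ.suc m) (ℕ.suc n)) ⟩
      ⊖ (ℕ.suc m · 1F ⊕ ℕ.suc n · 1F)                  ≡⟨ sym (-‿+-comm _ _) ⟩
      ⊖ (ℕ.suc m · 1F) ⊝ ℕ.suc n · 1F                  ∎

    ι-*⁺ : ∀ m j → ι (+ m * j) ≡ m · 1F ⊗ ι j
    ι-*⁺ m (+ n) = trans (cong ι (sym (ℤ.pos-* m n))) (×1-homo-* m n)
    ι-*⁺ m -[1+ n ] = begin
      ι (+ m * - + ℕ.suc n)          ≡⟨ cong ι (sym (ℤ.neg-distribʳ-* (+ m) (+ ℕ.suc n))) ⟩
      ι (- (+ m * + ℕ.suc n))        ≡⟨ ι-neg (+ m * + ℕ.suc n) ⟩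
      ⊖ ι (+ m * + ℕ.suc n)          ≡⟨ cong ⊖_ (ι-*⁺ m (+ ℕ.suc n)) ⟩
      ⊖ (m · 1F ⊗ ι (+ ℕ.suc n))     ≡⟨ -‿distribʳ-* _ _ ⟩
      m · 1F ⊗ ι -[1+ n ]            ∎

    ι-* : ∀ i j → ι (i * j) ≡ ι i ⊗ ι j
    ι-* (+ m) j = ι-*⁺ m j
    ι-* -[1+ m ] j = begin
      ι (- + ℕ.suc m * j)            ≡⟨ cong ι (sym (ℤ.neg-distribˡ-* (+ ℕ.suc m) j)) ⟩
      ι (- (+ ℕ.suc m * j))          ≡⟨ ι-neg (+ ℕ.suc m * j) ⟩
      ⊖ ι (+ ℕ.suc m * j)            ≡⟨ cong ⊖_ (ι-*⁺ (ℕ.suc m) j) ⟩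
      ⊖ (ℕ.suc m · 1F ⊗ ι j)         ≡⟨ -‿distribˡ-* _ _ ⟩
      ι -[1+ m ] ⊗ ι j               ∎

    ι-morphism : ℤ.+-*-rawRing ACR.-Raw-AlmostCommutative⟶ ACR.fromCommutativeRing commutativeRing
    ι-morphism = record
      { ⟦_⟧ = ι ; +-homo = ι-+ ; *-homo = ι-* ; -‿homo = ι-neg
      ; 0-homo = refl ; 1-homo = +-identityʳ 1F }

    ι-≟ : ∀ i j → Maybe (ι i ≡ ι j)
    ι-≟ i j with i ℤ.≟ j
    ... | yes i≡j = just (cong ι i≡j)
    ... | no _ = nothing

  open Algebra.Solver.Ring ℤ.+-*-rawRing (ACR.fromCommutativeRing commutativeRing) ι-morphism ι-≟ public
    using (solve; _:=_; _:+_; _:*_; :-_; _:-_)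

module FieldProperties {q : ℕ} (F : FiniteField q) where
  open FieldSolver F public
  open ≡-Reasoning

  1≢0 : 1F ≢ 0F
  1≢0 e = 0≢1 (sym e)

  ⊝≡0⇒≡ : ∀ {x y} → x ⊝ y ≡ 0F → x ≡ y
  ⊝≡0⇒≡ {x} {y} e = begin
    x            ≡⟨ solve 2 (λ x y → x := (x :- y) :+ y) refl x y ⟩
    (x ⊝ y) ⊕ y  ≡⟨ cong (_⊕ y) e ⟩
    0F ⊕ y       ≡⟨ +-identityˡ y ⟩
    y            ∎

  ≢⇒⊝≢0 : ∀ {x y} → x ≢ y → x ⊝ y ≢ 0F
  ≢⇒⊝≢0 x≢y e = x≢y (⊝≡0⇒≡ e)

  ⊖-≢0 : ∀ {x} → x ≢ 0F → ⊖ x ≢ 0F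
  ⊖-≢0 {x} x≢0 e = x≢0 (trans (sym (-‿involutive x)) (trans (cong ⊖_ e) -0#≈0#))

  ⊖-as-⊗ : ∀ x → ⊖ x ≡ ⊖ 1F ⊗ x
  ⊖-as-⊗ x = trans (cong ⊖_ (sym (*-identityˡ x))) (-‿distribˡ-* 1F x)

  inv : Carrier → Carrier
  inv x with x ≟F 0F
  ... | yes _ = 0F
  ... | no x≢0 = proj₁ (inverse x x≢0)

  inv-0 : inv 0F ≡ 0F
  inv-0 with 0F ≟F 0F
  ... | yes _ = refl
  ... | no 0≢0 = ⊥-elim (0≢0 refl)

  inv-inverseʳ : ∀ {x} → x ≢ 0F → x ⊗ inv x ≡ 1F
  inv-inverseʳ {x} x≢0 with x ≟F 0F
  ... | yes x≡0 = ⊥-elim (x≢0 x≡0)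
  ... | no x≢0 = proj₂ (inverse x x≢0)

  inv⊗-cancel : ∀ {x} → x ≢ 0F → ∀ y → inv x ⊗ (x ⊗ y) ≡ y
  inv⊗-cancel {x} x≢0 y = begin
    inv x ⊗ (x ⊗ y)  ≡⟨ solve 3 (λ i x y → i :* (x :* y) := (x :* i) :* y) refl (inv x) x y ⟩
    x ⊗ inv x ⊗ y    ≡⟨ cong (_⊗ y) (inv-inverseʳ x≢0) ⟩
    1F ⊗ y           ≡⟨ *-identityˡ y ⟩
    y                ∎

  ⊗inv⊗-cancel : ∀ {x} → x ≢ 0F → ∀ y → x ⊗ (inv x ⊗ y) ≡ y
  ⊗inv⊗-cancel {x} x≢0 y = begin
    x ⊗ (inv x ⊗ y)  ≡⟨ sym (*-assoc x (inv x) y) ⟩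
    x ⊗ inv x ⊗ y    ≡⟨ cong (_⊗ y) (inv-inverseʳ x≢0) ⟩
    1F ⊗ y           ≡⟨ *-identityˡ y ⟩
    y                ∎

  zero-product : ∀ x y → x ⊗ y ≡ 0F → x ≡ 0F ⊎ y ≡ 0F
  zero-product x y e with x ≟F 0F
  ... | yes x≡0 = inj₁ x≡0
  ... | no x≢0 = inj₂ (begin
    y                ≡⟨ sym (inv⊗-cancel x≢0 y) ⟩
    inv x ⊗ (x ⊗ y)  ≡⟨ cong (inv x ⊗_) e ⟩
    inv x ⊗ 0F       ≡⟨ zeroʳ (inv x) ⟩
    0F               ∎)

  ⊗-≢0 : ∀ {x y} → x ≢ 0F → y ≢ 0F → x ⊗ y ≢ 0F
  ⊗-≢0 {x} {y} x≢0 y≢0 e with zero-product x y e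
  ... | inj₁ x≡0 = x≢0 x≡0
  ... | inj₂ y≡0 = y≢0 y≡0

  inv-≢0 : ∀ {x} → x ≢ 0F → inv x ≢ 0F
  inv-≢0 {x} x≢0 e = 1≢0 (trans (sym (inv-inverseʳ x≢0)) (trans (cong (x ⊗_) e) (zeroʳ x)))

  inv-involutive : ∀ x → inv (inv x) ≡ x
  inv-involutive x = by-cases (x ≟F 0F)
    where
    by-cases : Dec (x ≡ 0F) → inv (inv x) ≡ x
    by-cases (yes x≡0) = trans (cong (λ z → inv (inv z)) x≡0) (trans (cong inv inv-0) (trans inv-0 (sym x≡0)))
    by-cases (no x≢0) = begin
      inv (inv x)                   ≡⟨ sym (*-identityʳ _) ⟩
      inv (inv x) ⊗ 1F              ≡⟨ cong (inv (inv x) ⊗_) (sym (trans (*-comm _ _) (inv-inverseʳ x≢0))) ⟩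
      inv (inv x) ⊗ (inv x ⊗ x)     ≡⟨ solve 3 (λ a b c → a :* (b :* c) := (b :* a) :* c) refl _ _ x ⟩
      inv x ⊗ inv (inv x) ⊗ x       ≡⟨ cong (_⊗ x) (inv-inverseʳ (inv-≢0 x≢0)) ⟩
      1F ⊗ x                        ≡⟨ *-identityˡ x ⟩
      x                             ∎

  square-⊗ : ∀ {x y} → IsSquare x → IsSquare y → IsSquare (x ⊗ y)
  square-⊗ {x} {y} (a , a²≡x) (b , b²≡y) = a ⊗ b , (begin
    a ⊗ b ⊗ (a ⊗ b)      ≡⟨ solve 2 (λ a b → a :* b :* (a :* b) := a :* a :* (b :* b)) refl a b ⟩
    a ⊗ a ⊗ (b ⊗ b)      ≡⟨ cong₂ _⊗_ a²≡x b²≡y ⟩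
    x ⊗ y                ∎)

  square⊗nonsquare : ∀ {x y} → x ≢ 0F → IsSquare x → ¬ IsSquare y → ¬ IsSquare (x ⊗ y)
  square⊗nonsquare {x} {y} x≢0 (a , a²≡x) y-nonsquare (b , b²≡xy) =
    y-nonsquare (inv a ⊗ b , (begin
      inv a ⊗ b ⊗ (inv a ⊗ b)      ≡⟨ solve 2 (λ i b → i :* b :* (i :* b) := i :* (i :* (b :* b))) refl (inv a) b ⟩
      inv a ⊗ (inv a ⊗ (b ⊗ b))    ≡⟨ cong (λ z → inv a ⊗ (inv a ⊗ z)) (trans b²≡xy (cong (_⊗ y) (sym a²≡x))) ⟩
      inv a ⊗ (inv a ⊗ (a ⊗ a ⊗ y)) ≡⟨ cong (λ z → inv a ⊗ (inv a ⊗ z)) (*-assoc a a y) ⟩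
      inv a ⊗ (inv a ⊗ (a ⊗ (a ⊗ y))) ≡⟨ cong (inv a ⊗_) (inv⊗-cancel a≢0 (a ⊗ y)) ⟩
      inv a ⊗ (a ⊗ y)              ≡⟨ inv⊗-cancel a≢0 y ⟩
      y                            ∎))
    where
    a≢0 : a ≢ 0F
    a≢0 a≡0 = x≢0 (trans (sym a²≡x) (trans (cong (_⊗ a) a≡0) (zeroˡ a)))

  ⊗-self-≡ : ∀ y r → y ⊗ y ≡ r ⊗ r → y ≡ r ⊎ y ≡ ⊖ r
  ⊗-self-≡ y r e = Sum.map ⊝≡0⇒≡ (λ y+r≡0 → ⊝≡0⇒≡ (trans (solve 2 (λ y r → y :- (:- r) := y :+ r) refl y r) y+r≡0))
                           (zero-product (y ⊝ r) (y ⊕ r) (begin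
    (y ⊝ r) ⊗ (y ⊕ r) ≡⟨ solve 2 (λ y r → (y :- r) :* (y :+ r) := y :* y :- r :* r) refl y r ⟩
    y ⊗ y ⊝ r ⊗ r     ≡⟨ cong (_⊝ r ⊗ r) e ⟩
    r ⊗ r ⊝ r ⊗ r     ≡⟨ -‿inverseʳ _ ⟩
    0F                ∎))

  data Residue (x : Carrier) : Set where
    zero      : x ≡ 0F → Residue x
    square    : x ≢ 0F → IsSquare x → Residue x
    nonsquare : x ≢ 0F → ¬ IsSquare x → Residue x

  residue : ∀ x → Residue x
  residue x with x ≟F 0F | isSquare? x
  ... | yes x≡0 | _ = zero x≡0
  ... | no x≢0 | yes s = square x≢0 s
  ... | no x≢0 | no ¬s = nonsquare x≢0 ¬s

  InD0? : ∀ x → Dec (InD0 x)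
  InD0? x = ¬? (x ≟F 0F) ×-dec isSquare? x

  InD1? : ∀ x → Dec (InD1 x)
  InD1? x = ¬? (x ≟F 0F) ×-dec ¬? (isSquare? x)

  inD0-zero : ∀ {x} → x ≡ 0F → inD0 x ≡ false
  inD0-zero {x} x≡0 = dec-false (InD0? x) (λ (x≢0 , _) → x≢0 x≡0)

  inD1-zero : ∀ {x} → x ≡ 0F → inD1 x ≡ false
  inD1-zero {x} x≡0 = dec-false (InD1? x) (λ (x≢0 , _) → x≢0 x≡0)

  inD0-square : ∀ {x} → x ≢ 0F → IsSquare x → inD0 x ≡ true
  inD0-square {x} x≢0 s = dec-true (InD0? x) (x≢0 , s)

  inD1-square : ∀ {x} → IsSquare x → inD1 x ≡ false
  inD1-square {x} s = dec-false (InD1? x) (λ (_ , ¬s) → ¬s s)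

  inD0-nonsquare : ∀ {x} → ¬ IsSquare x → inD0 x ≡ false
  inD0-nonsquare {x} ¬s = dec-false (InD0? x) (λ (_ , s) → ¬s s)

  inD1-nonsquare : ∀ {x} → x ≢ 0F → ¬ IsSquare x → inD1 x ≡ true
  inD1-nonsquare {x} x≢0 ¬s = dec-true (InD1? x) (x≢0 , ¬s)

  inD0-sound : ∀ {x} → inD0 x ≡ true → InD0 x
  inD0-sound {x} e = subst (λ b → if b then InD0 x else ¬ InD0 x) e (invert (proof (InD0? x)))

  χ : Carrier → ℤ
  χ x = [ inD0 x ] - [ inD1 x ]

  χ-zero : ∀ {x} → x ≡ 0F → χ x ≡ 0ℤ
  χ-zero x≡0 rewrite inD0-zero x≡0 | inD1-zero x≡0 = refl

  χ-square : ∀ {x} → x ≢ 0F → IsSquare x → χ x ≡ 1ℤ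
  χ-square x≢0 s rewrite inD0-square x≢0 s | inD1-square s = refl

  χ-nonsquare : ∀ {x} → x ≢ 0F → ¬ IsSquare x → χ x ≡ -1ℤ
  χ-nonsquare x≢0 ¬s rewrite inD0-nonsquare ¬s | inD1-nonsquare x≢0 ¬s = refl

  χ-1 : χ 1F ≡ 1ℤ
  χ-1 = χ-square 1≢0 (1F , *-identityʳ 1F)

  inD1≡not-inD0 : ∀ {x} → x ≢ 0F → inD1 x ≡ not (inD0 x)
  inD1≡not-inD0 {x} x≢0 with residue x
  ... | zero x≡0 = ⊥-elim (x≢0 x≡0)
  ... | square _ s rewrite inD0-square x≢0 s | inD1-square s = refl
  ... | nonsquare _ ¬s rewrite inD0-nonsquare ¬s | inD1-nonsquare x≢0 ¬s = refl

  χ≡sgn-inD0 : ∀ {x} → x ≢ 0F → χ x ≡ sgn (inD0 x)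
  χ≡sgn-inD0 {x} x≢0 = cong (λ b → [ inD0 x ] - [ b ]) (inD1≡not-inD0 x≢0)

module FieldSums {q : ℕ} (F : FiniteField q) where
  open FieldProperties F public
  open import Function.Bundles using (Inverse)
  open ≡-Reasoning

  private
    to : Fin q → Carrier
    to = Inverse.to enum

    from : Carrier → Fin q
    from = Inverse.from enum

    to-from : ∀ x → to (from x) ≡ x
    to-from = Inverse.strictlyInverseˡ enum

    from-to : ∀ i → from (to i) ≡ i
    from-to = Inverse.strictlyInverseʳ enum

  ∑ : (Carrier → ℤ) → ℤ
  ∑ f = sum (λ i → f (to i))

  ∑-cong : ∀ {f g : Carrier → ℤ} → (∀ x → f x ≡ g x) → ∑ f ≡ ∑ g
  ∑-cong f≗g = sum-cong-≗ (λ i → f≗g (to i))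

  ∑-+ : ∀ (f g : Carrier → ℤ) → ∑ (λ x → f x + g x) ≡ ∑ f + ∑ g
  ∑-+ f g = ∑-distrib-+ (f ∘ to) (g ∘ to)

  ∑-*ˡ : ∀ c (f : Carrier → ℤ) → ∑ (λ x → c * f x) ≡ c * ∑ f
  ∑-*ˡ c f = sym (*-distribˡ-sum c (f ∘ to))

  ∑-neg : ∀ (f : Carrier → ℤ) → ∑ (λ x → - f x) ≡ - ∑ f
  ∑-neg f = sum-neg (f ∘ to)

  ∑-const : ∀ c → ∑ (λ _ → c) ≡ + q * c
  ∑-const c = sum-const q c

  ∑-comm : ∀ (f : Carrier → Carrier → ℤ) → ∑ (λ x → ∑ (λ y → f x y)) ≡ ∑ (λ y → ∑ (λ x → f x y))
  ∑-comm f = sum-comm (λ i j → f (to i) (to j))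

  ∑-reindex : ∀ (σ τ : Carrier → Carrier) → (∀ x → σ (τ x) ≡ x) → (∀ x → τ (σ x) ≡ x) →
              ∀ (f : Carrier → ℤ) → ∑ (λ x → f (σ x)) ≡ ∑ f
  ∑-reindex σ τ στ τσ f = sym (begin
    ∑ f                                       ≡⟨ ∑-permute (f ∘ to) π ⟩
    sum (λ i → f (to (from (σ (to i)))))      ≡⟨ sum-cong-≗ (λ i → cong f (to-from (σ (to i)))) ⟩
    ∑ (λ x → f (σ x))                         ∎)
    where
    π : Permutation q q
    π = permutation (λ i → from (σ (to i))) (λ i → from (τ (to i)))
          (λ i → trans (cong (λ z → from (σ z)) (to-from _)) (trans (cong from (στ _)) (from-to i)))
          (λ i → trans (cong (λ z → from (τ z)) (to-from _)) (trans (cong from (τσ _)) (from-to i)))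

  ∑-reflect : ∀ a (f : Carrier → ℤ) → ∑ (λ g → f (a ⊝ g)) ≡ ∑ f
  ∑-reflect a = ∑-reindex (a ⊝_) (a ⊝_) reflect² reflect²
    where
    reflect² : ∀ g → a ⊝ (a ⊝ g) ≡ g
    reflect² = solve 2 (λ a g → a :- (a :- g) := g) refl a

  ∑-translate : ∀ a (f : Carrier → ℤ) → ∑ (λ y → f (y ⊝ a)) ≡ ∑ f
  ∑-translate a = ∑-reindex (_⊝ a) (_⊕ a)
    (λ y → solve 2 (λ y a → y :+ a :- a := y) refl y a) (λ y → solve 2 (λ y a → y :- a :+ a := y) refl y a)

  δ : Carrier → Carrier → ℤ
  δ x a = [ does (x ≟F a) ]

  δ-≡ : ∀ {x a} → x ≡ a → δ x a ≡ 1ℤ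
  δ-≡ {x} {a} x≡a = cong [_] (dec-true (x ≟F a) x≡a)

  δ-≢ : ∀ {x a} → x ≢ a → δ x a ≡ 0ℤ
  δ-≢ {x} {a} x≢a = cong [_] (dec-false (x ≟F a) x≢a)

  ∑-pick : ∀ (f : Carrier → ℤ) a → ∑ (λ x → δ x a * f x) ≡ f a
  ∑-pick f a = begin
    ∑ (λ x → δ x a * f x)
      ≡⟨ sum-cong-≗ (λ i → cong (λ b → [ b ] * f (to i)) (does-⇔ (to≡⇔≡from i) (to i ≟F a) (i Fin.≟ from a))) ⟩
    sum (λ i → [ does (i Fin.≟ from a) ] * f (to i))      ≡⟨ sum-pick (f ∘ to) (from a) ⟩
    f (to (from a))                                       ≡⟨ cong f (to-from a) ⟩
    f a                                                   ∎
    where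
    to≡⇔≡from : ∀ i → to i ≡ a ⇔ i ≡ from a
    to≡⇔≡from i = mk⇔ (λ e → trans (sym (from-to i)) (cong from e)) (λ e → trans (cong to e) (to-from a))

  ∑-δ : ∀ a → ∑ (λ x → δ x a) ≡ 1ℤ
  ∑-δ a = trans (∑-cong (λ x → sym (ℤ.*-identityʳ (δ x a)))) (∑-pick (λ _ → 1ℤ) a)

  ∑-+₄ : ∀ (f g h i : Carrier → ℤ) → ∑ (λ x → f x + g x + h x + i x) ≡ ∑ f + ∑ g + ∑ h + ∑ i
  ∑-+₄ f g h i = begin
    ∑ (λ x → f x + g x + h x + i x)     ≡⟨ ∑-+ (λ x → f x + g x + h x) i ⟩
    ∑ (λ x → f x + g x + h x) + ∑ i     ≡⟨ cong (_+ ∑ i) (∑-+ (λ x → f x + g x) h) ⟩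
    ∑ (λ x → f x + g x) + ∑ h + ∑ i     ≡⟨ cong (λ z → z + ∑ h + ∑ i) (∑-+ f g) ⟩
    ∑ f + ∑ g + ∑ h + ∑ i               ∎

  ∑-witness : ∀ (f : Carrier → ℤ) → ∑ f ≢ 0ℤ → ∃ λ x → f x ≢ 0ℤ
  ∑-witness f ∑≢0 with sum-witness (f ∘ to) ∑≢0
  ... | i , fi≢0 = to i , fi≢0

  ∑-[]-⊆-equal : ∀ (P Q : Carrier → Bool) → (∀ x → P x ≡ true → Q x ≡ true) →
    ∑ (λ x → [ P x ]) ≡ ∑ (λ x → [ Q x ]) → ∀ x → Q x ≡ true → P x ≡ true
  ∑-[]-⊆-equal P Q P⊆Q same-size x Qx =
    subst (λ y → P y ≡ true) (to-from x)
      (sum-[]-⊆-equal (P ∘ to) (Q ∘ to) (λ i → P⊆Q (to i)) same-size (from x)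
        (subst (λ y → Q y ≡ true) (sym (to-from x)) Qx))

  length-filter-map-elements : ∀ {A : Set} (b : A → Bool) (h : Carrier → A) →
    + length (filter (λ y → b y Bool.≟ true) (map h elements)) ≡ ∑ (λ x → [ b (h x) ])
  length-filter-map-elements b h = begin
    + length (filter _ (map h (map to (tabulate (λ i → i)))))
      ≡⟨ cong (λ l → + length (filter (λ y → b y Bool.≟ true) l))
           (trans (sym (map-∘ (tabulate (λ i → i)))) (map-tabulate (λ i → i) (h ∘ to))) ⟩
    + length (filter _ (tabulate (h ∘ to)))  ≡⟨ length-filter-tabulate b (h ∘ to) ⟩
    ∑ (λ x → [ b (h x) ])                    ∎

  length-filter-elements : ∀ (b : Carrier → Bool) →
    + length (filter (λ y → b y Bool.≟ true) elements) ≡ ∑ (λ x → [ b x ])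
  length-filter-elements b = begin
    + length (filter (λ y → b y Bool.≟ true) elements)
      ≡⟨ cong (λ ys → + length (filter (λ y → b y Bool.≟ true) ys)) (sym (map-id elements)) ⟩
    + length (filter (λ y → b y Bool.≟ true) (map (λ y → y) elements))
      ≡⟨ length-filter-map-elements b (λ y → y) ⟩
    ∑ (λ x → [ b x ])  ∎

  ∑-involution-even : ∀ (σ : Carrier → Carrier) (P : Carrier → Bool) →
    (∀ x → σ (σ x) ≡ x) → (∀ x → P (σ x) ≡ P x) → (∀ x → P x ≡ true → σ x ≢ x) →
    ∃ λ n → ∑ (λ x → [ P x ]) ≡ + (2 ℕ.* n)
  ∑-involution-even σ P σ-involutive P-invariant fixed-point-free =
    n , (begin
      ∑ (λ x → [ P x ])                                  ≡⟨ ∑-cong split ⟩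
      ∑ (λ x → [ P x ∧ below x ] + [ P x ∧ above x ])    ≡⟨ ∑-+ (λ x → [ P x ∧ below x ]) (λ x → [ P x ∧ above x ]) ⟩
      ∑ (λ x → [ P x ∧ below x ]) + ∑ (λ x → [ P x ∧ above x ])
        ≡⟨ cong (_+_ (∑ (λ x → [ P x ∧ below x ])))
             (trans (sym (∑-reindex σ σ σ-involutive σ-involutive (λ x → [ P x ∧ above x ]))) (∑-cong above-σ)) ⟩
      ∑ (λ x → [ P x ∧ below x ]) + ∑ (λ x → [ P x ∧ below x ])
        ≡⟨ cong (λ n → n + n) (sym (length-filter-elements (λ x → P x ∧ below x))) ⟩
      + (n ℕ.+ n)                                        ≡⟨ cong (λ m → + (n ℕ.+ m)) (sym (ℕ.+-identityʳ n)) ⟩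
      + (2 ℕ.* n)                                        ∎)
    where
    -- below selects one point of each orbit {x , σ x}.
    below above : Carrier → Bool
    below x = does (from x Fin.<? from (σ x))
    above x = does (from (σ x) Fin.<? from x)

    n : ℕ
    n = length (filter (λ y → (P y ∧ below y) Bool.≟ true) elements)

    split : ∀ x → [ P x ] ≡ [ P x ∧ below x ] + [ P x ∧ above x ]
    split x with P x in Px
    ... | false = refl
    ... | true with Fin.<-cmp (from x) (from (σ x))
    ...   | tri< x<σx _ σx≮x = sym (cong₂ (λ b c → [ b ] + [ c ]) (dec-true (_ Fin.<? _) x<σx) (dec-false (_ Fin.<? _) σx≮x))
    ...   | tri> x≮σx _ σx<x = sym (cong₂ (λ b c → [ b ] + [ c ]) (dec-false (_ Fin.<? _) x≮σx) (dec-true (_ Fin.<? _) σx<x))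
    ...   | tri≈ _ x≈σx _ =
      ⊥-elim (fixed-point-free x Px (trans (sym (to-from (σ x))) (trans (cong to (sym x≈σx)) (to-from x))))

    above-σ : ∀ x → [ P (σ x) ∧ above (σ x) ] ≡ [ P x ∧ below x ]
    above-σ x rewrite P-invariant x | σ-involutive x = refl

module OddOrder {q : ℕ} (F : FiniteField q) (k : ℕ) (q≡2k+1 : q ≡ ℕ.suc (2 ℕ.* k)) where
  open FieldSums F public
  open ≡-Reasoning

  ∑-1 : ∑ (λ _ → 1ℤ) ≡ + ℕ.suc (2 ℕ.* k)
  ∑-1 = trans (∑-const 1ℤ) (trans (ℤ.*-identityʳ (+ q)) (cong +_ q≡2k+1))

  1+1≢0 : 1F ⊕ 1F ≢ 0F
  1+1≢0 1+1≡0 =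
    let n , ∑1≡2n = ∑-involution-even (_⊕ 1F) (λ _ → true) +1+1 (λ _ → refl) (λ x _ → x+1≢x x)
    in ℕ.even≢odd n k (ℤ.+-injective (trans (sym ∑1≡2n) ∑-1))
    where
    +1+1 : ∀ x → x ⊕ 1F ⊕ 1F ≡ x
    +1+1 x = trans (+-assoc x 1F 1F) (trans (cong (x ⊕_) 1+1≡0) (+-identityʳ x))
    x+1≢x : ∀ x → x ⊕ 1F ≢ x
    x+1≢x x e = 1≢0 (trans (solve 2 (λ x o → o := x :+ o :- x) refl x 1F) (trans (cong (_⊝ x) e) (-‿inverseʳ x)))

  x≢⊖x : ∀ {x} → x ≢ 0F → x ≢ ⊖ x
  x≢⊖x {x} x≢0 x≡-x with zero-product x (1F ⊕ 1F) (begin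
      x ⊗ (1F ⊕ 1F)  ≡⟨ solve 2 (λ x o → x :* (o :+ o) := x :* o :+ x :* o) refl x 1F ⟩
      x ⊗ 1F ⊕ x ⊗ 1F ≡⟨ cong (λ z → z ⊕ z) (*-identityʳ x) ⟩
      x ⊕ x          ≡⟨ cong (x ⊕_) x≡-x ⟩
      x ⊝ x          ≡⟨ -‿inverseʳ x ⟩
      0F             ∎)
  ... | inj₁ x≡0 = x≢0 x≡0
  ... | inj₂ 1+1≡0 = 1+1≢0 1+1≡0

  δ-square : ∀ {r} → r ≢ 0F → ∀ y → δ (r ⊗ r) (y ⊗ y) ≡ δ y r + δ y (⊖ r)
  δ-square {r} r≢0 y with y ≟F r | y ≟F (⊖ r)
  ... | yes y≡r | yes y≡-r = ⊥-elim (x≢⊖x r≢0 (trans (sym y≡r) y≡-r))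
  ... | yes refl | no _ = δ-≡ refl
  ... | no _ | yes refl = δ-≡ (solve 1 (λ r → r :* r := :- r :* :- r) refl r)
  ... | no y≢r | no y≢-r = δ-≢ λ e → [ y≢r , y≢-r ]′ (⊗-self-≡ y r (sym e))

  ∑-δ-square : ∀ x → ∑ (λ y → δ x (y ⊗ y) * [ inD0 x ]) ≡ + 2 * [ inD0 x ]
  ∑-δ-square x with inD0 x in inD0x
  ... | false = trans (∑-cong (λ y → ℤ.*-zeroʳ (δ x (y ⊗ y)))) (trans (∑-const 0ℤ) (ℤ.*-zeroʳ (+ q)))
  ... | true with inD0-sound inD0x
  ...   | x≢0 , r , refl = begin
    ∑ (λ y → δ (r ⊗ r) (y ⊗ y) * 1ℤ)  ≡⟨ ∑-cong (λ y → trans (ℤ.*-identityʳ _) (δ-square r≢0 y)) ⟩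
    ∑ (λ y → δ y r + δ y (⊖ r))       ≡⟨ ∑-+ (λ y → δ y r) (λ y → δ y (⊖ r)) ⟩
    ∑ (λ y → δ y r) + ∑ (λ y → δ y (⊖ r)) ≡⟨ cong₂ _+_ (∑-δ r) (∑-δ (⊖ r)) ⟩
    + 2                               ∎
    where
    r≢0 : r ≢ 0F
    r≢0 r≡0 = x≢0 (trans (cong (_⊗ r) r≡0) (zeroˡ r))

  inD0-square-of : ∀ y → [ inD0 (y ⊗ y) ] ≡ 1ℤ - δ y 0F
  inD0-square-of y with y ≟F 0F
  ... | yes y≡0 rewrite inD0-zero (trans (cong (_⊗ y) y≡0) (zeroˡ y)) = refl
  ... | no y≢0 rewrite inD0-square (⊗-≢0 y≢0 y≢0) (y , refl) = refl

  ∑-inD0 : ∑ (λ x → [ inD0 x ]) ≡ + k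
  ∑-inD0 = ℤ.*-cancelˡ-≡ (+ 2) _ _ (begin
    + 2 * ∑ (λ x → [ inD0 x ])                      ≡⟨ sym (∑-*ˡ (+ 2) (λ x → [ inD0 x ])) ⟩
    ∑ (λ x → + 2 * [ inD0 x ])                      ≡⟨ sym (∑-cong ∑-δ-square) ⟩
    ∑ (λ x → ∑ (λ y → δ x (y ⊗ y) * [ inD0 x ]))    ≡⟨ ∑-comm (λ x y → δ x (y ⊗ y) * [ inD0 x ]) ⟩
    ∑ (λ y → ∑ (λ x → δ x (y ⊗ y) * [ inD0 x ]))    ≡⟨ ∑-cong (λ y → ∑-pick (λ x → [ inD0 x ]) (y ⊗ y)) ⟩
    ∑ (λ y → [ inD0 (y ⊗ y) ])                      ≡⟨ ∑-cong inD0-square-of ⟩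
    ∑ (λ y → 1ℤ - δ y 0F)                           ≡⟨ ∑-+ (λ _ → 1ℤ) (λ y → - δ y 0F) ⟩
    ∑ (λ _ → 1ℤ) + ∑ (λ y → - δ y 0F)               ≡⟨ cong₂ _+_ ∑-1 (trans (∑-neg (λ y → δ y 0F)) (cong -_ (∑-δ 0F))) ⟩
    + ℕ.suc (2 ℕ.* k) - 1ℤ                          ≡⟨ ℤ.pos-* 2 k ⟩
    + 2 * + k                                       ∎)

  ∑-inD1 : ∑ (λ x → [ inD1 x ]) ≡ + k
  ∑-inD1 = ∙-cancelˡ (+ k) _ _ (∙-cancelʳ 1ℤ _ _ (begin
    + k + ∑ (λ x → [ inD1 x ]) + 1ℤ
      ≡⟨ cong₂ (λ a b → a + ∑ (λ x → [ inD1 x ]) + b) (sym ∑-inD0) (sym (∑-δ 0F)) ⟩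
    ∑ (λ x → [ inD0 x ]) + ∑ (λ x → [ inD1 x ]) + ∑ (λ x → δ x 0F)
      ≡⟨ cong (_+ ∑ (λ x → δ x 0F)) (sym (∑-+ (λ x → [ inD0 x ]) (λ x → [ inD1 x ]))) ⟩
    ∑ (λ x → [ inD0 x ] + [ inD1 x ]) + ∑ (λ x → δ x 0F)
      ≡⟨ sym (∑-+ (λ x → [ inD0 x ] + [ inD1 x ]) (λ x → δ x 0F)) ⟩
    ∑ (λ x → [ inD0 x ] + [ inD1 x ] + δ x 0F)   ≡⟨ ∑-cong one-class ⟩
    ∑ (λ _ → 1ℤ)                                ≡⟨ ∑-1 ⟩
    + ℕ.suc (2 ℕ.* k)                           ≡⟨ cong +_ (1+2k≡k+k+1 k) ⟩
    + k + + k + 1ℤ                              ∎))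
    where
    one-class : ∀ x → [ inD0 x ] + [ inD1 x ] + δ x 0F ≡ 1ℤ
    one-class x with residue x
    ... | zero x≡0 rewrite inD0-zero x≡0 | inD1-zero x≡0 | δ-≡ x≡0 = refl
    ... | square x≢0 s rewrite inD0-square x≢0 s | inD1-square s | δ-≢ x≢0 = refl
    ... | nonsquare x≢0 ¬s rewrite inD0-nonsquare ¬s | inD1-nonsquare x≢0 ¬s | δ-≢ x≢0 = refl
    1+2k≡k+k+1 : ∀ n → ℕ.suc (2 ℕ.* n) ≡ n ℕ.+ n ℕ.+ 1
    1+2k≡k+k+1 = ℕ-solve-∀

  nonsquare⊗nonsquare : ∀ {n x} → n ≢ 0F → ¬ IsSquare n → x ≢ 0F → ¬ IsSquare x → IsSquare (n ⊗ x)
  nonsquare⊗nonsquare {n} {x} n≢0 ¬sn x≢0 ¬sx =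
    proj₂ (inD0-sound (∑-[]-⊆-equal (λ y → inD0 (n ⊗ y)) inD1 D0-to-D1 same-size x (inD1-nonsquare x≢0 ¬sx)))
    where
    D0-to-D1 : ∀ y → inD0 (n ⊗ y) ≡ true → inD1 y ≡ true
    D0-to-D1 y ny∈D0 with inD0-sound ny∈D0
    ... | ny≢0 , sny = inD1-nonsquare y≢0 (λ sy → square⊗nonsquare y≢0 sy ¬sn (subst IsSquare (*-comm n y) sny))
      where
      y≢0 : y ≢ 0F
      y≢0 y≡0 = ny≢0 (trans (cong (n ⊗_) y≡0) (zeroʳ n))

    same-size : ∑ (λ y → [ inD0 (n ⊗ y) ]) ≡ ∑ (λ y → [ inD1 y ])
    same-size = begin
      ∑ (λ y → [ inD0 (n ⊗ y) ])  ≡⟨ ∑-reindex (n ⊗_) (inv n ⊗_) (⊗inv⊗-cancel n≢0) (inv⊗-cancel n≢0) (λ y → [ inD0 y ]) ⟩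
      ∑ (λ y → [ inD0 y ])        ≡⟨ trans ∑-inD0 (sym ∑-inD1) ⟩
      ∑ (λ y → [ inD1 y ])        ∎

  χ-⊗ : ∀ x y → χ (x ⊗ y) ≡ χ x * χ y
  χ-⊗ x y with residue x | residue y
  ... | zero x≡0 | _ = trans (χ-zero (trans (cong (_⊗ y) x≡0) (zeroˡ y))) (cong (_* χ y) (sym (χ-zero x≡0)))
  ... | _ | zero y≡0 = trans (χ-zero (trans (cong (x ⊗_) y≡0) (zeroʳ x)))
                         (trans (sym (ℤ.*-zeroʳ (χ x))) (cong (χ x *_) (sym (χ-zero y≡0))))
  ... | square x≢0 sx | square y≢0 sy =
    trans (χ-square (⊗-≢0 x≢0 y≢0) (square-⊗ sx sy)) (sym (cong₂ _*_ (χ-square x≢0 sx) (χ-square y≢0 sy)))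
  ... | square x≢0 sx | nonsquare y≢0 ¬sy =
    trans (χ-nonsquare (⊗-≢0 x≢0 y≢0) (square⊗nonsquare x≢0 sx ¬sy))
          (sym (cong₂ _*_ (χ-square x≢0 sx) (χ-nonsquare y≢0 ¬sy)))
  ... | nonsquare x≢0 ¬sx | square y≢0 sy =
    trans (χ-nonsquare (⊗-≢0 x≢0 y≢0) (λ s → square⊗nonsquare y≢0 sy ¬sx (subst IsSquare (*-comm x y) s)))
          (sym (cong₂ _*_ (χ-nonsquare x≢0 ¬sx) (χ-square y≢0 sy)))
  ... | nonsquare x≢0 ¬sx | nonsquare y≢0 ¬sy =
    trans (χ-square (⊗-≢0 x≢0 y≢0) (nonsquare⊗nonsquare x≢0 ¬sx y≢0 ¬sy))
          (sym (cong₂ _*_ (χ-nonsquare x≢0 ¬sx) (χ-nonsquare y≢0 ¬sy)))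

  ∑-χ : ∑ χ ≡ 0ℤ
  ∑-χ = begin
    ∑ (λ x → [ inD0 x ] - [ inD1 x ])             ≡⟨ ∑-+ (λ x → [ inD0 x ]) (λ x → - [ inD1 x ]) ⟩
    ∑ (λ x → [ inD0 x ]) + ∑ (λ x → - [ inD1 x ]) ≡⟨ cong₂ _+_ ∑-inD0 (trans (∑-neg (λ x → [ inD1 x ])) (cong -_ ∑-inD1)) ⟩
    + k - + k                                     ≡⟨ ℤ.+-inverseʳ (+ k) ⟩
    0ℤ                                            ∎

  -- τ h = (h + d) / h for h ≢ 0 and τ 0 = 1 (as inv 0F = 0F) is a permutation of the field.
  ∑-χ-χ-shift : ∀ {d} → d ≢ 0F → ∑ (λ h → χ h * χ (h ⊕ d)) ≡ -1ℤ
  ∑-χ-χ-shift {d} d≢0 = begin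
    ∑ (λ h → χ h * χ (h ⊕ d))                 ≡⟨ ∑-cong χ-χ-shift ⟩
    ∑ (λ h → χ (τ h) - δ h 0F)                ≡⟨ ∑-+ (λ h → χ (τ h)) (λ h → - δ h 0F) ⟩
    ∑ (λ h → χ (τ h)) + ∑ (λ h → - δ h 0F)    ≡⟨ cong₂ _+_ (trans (∑-reindex τ τ⁻¹ τ∘τ⁻¹ τ⁻¹∘τ χ) ∑-χ)
                                                            (trans (∑-neg (λ h → δ h 0F)) (cong -_ (∑-δ 0F))) ⟩
    -1ℤ                                       ∎
    where
    τ τ⁻¹ : Carrier → Carrier
    τ h = 1F ⊕ d ⊗ inv h
    τ⁻¹ u = inv (inv d ⊗ (u ⊝ 1F))

    τ∘τ⁻¹ : ∀ u → τ (τ⁻¹ u) ≡ u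
    τ∘τ⁻¹ u = begin
      1F ⊕ d ⊗ inv (inv (inv d ⊗ (u ⊝ 1F)))  ≡⟨ cong (λ z → 1F ⊕ d ⊗ z) (inv-involutive _) ⟩
      1F ⊕ d ⊗ (inv d ⊗ (u ⊝ 1F))            ≡⟨ cong (1F ⊕_) (⊗inv⊗-cancel d≢0 _) ⟩
      1F ⊕ (u ⊝ 1F)                          ≡⟨ solve 2 (λ o u → o :+ (u :- o) := u) refl 1F u ⟩
      u                                      ∎

    τ⁻¹∘τ : ∀ h → τ⁻¹ (τ h) ≡ h
    τ⁻¹∘τ h = begin
      inv (inv d ⊗ (1F ⊕ d ⊗ inv h ⊝ 1F))  ≡⟨ cong (λ z → inv (inv d ⊗ z)) (solve 2 (λ o x → o :+ x :- o := x) refl 1F _) ⟩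
      inv (inv d ⊗ (d ⊗ inv h))            ≡⟨ cong inv (inv⊗-cancel d≢0 _) ⟩
      inv (inv h)                          ≡⟨ inv-involutive h ⟩
      h                                    ∎

    χ-χ-shift : ∀ h → χ h * χ (h ⊕ d) ≡ χ (τ h) - δ h 0F
    χ-χ-shift h = by-zero (h ≟F 0F)
      where
      by-zero : Dec (h ≡ 0F) → χ h * χ (h ⊕ d) ≡ χ (τ h) - δ h 0F
      by-zero (yes h≡0) = begin
        χ h * χ (h ⊕ d)     ≡⟨ cong (_* χ (h ⊕ d)) (χ-zero h≡0) ⟩
        0ℤ                  ≡⟨ sym (ℤ.+-inverseʳ 1ℤ) ⟩
        1ℤ - 1ℤ             ≡⟨ cong₂ _-_ (sym (trans (cong χ τh≡1) χ-1)) (sym (δ-≡ h≡0)) ⟩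
        χ (τ h) - δ h 0F    ∎
        where
        τh≡1 : τ h ≡ 1F
        τh≡1 = begin
          1F ⊕ d ⊗ inv h    ≡⟨ cong (λ z → 1F ⊕ d ⊗ inv z) h≡0 ⟩
          1F ⊕ d ⊗ inv 0F   ≡⟨ cong (λ z → 1F ⊕ d ⊗ z) inv-0 ⟩
          1F ⊕ d ⊗ 0F       ≡⟨ cong (1F ⊕_) (zeroʳ d) ⟩
          1F ⊕ 0F           ≡⟨ +-identityʳ 1F ⟩
          1F                ∎
      by-zero (no h≢0) = begin
        χ h * χ (h ⊕ d)           ≡⟨ sym (χ-⊗ h (h ⊕ d)) ⟩
        χ (h ⊗ (h ⊕ d))           ≡⟨ cong χ h[h+d]≡h²τh ⟩
        χ (h ⊗ h ⊗ τ h)           ≡⟨ χ-⊗ (h ⊗ h) (τ h) ⟩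
        χ (h ⊗ h) * χ (τ h)       ≡⟨ cong (_* χ (τ h)) (χ-square (⊗-≢0 h≢0 h≢0) (h , refl)) ⟩
        1ℤ * χ (τ h)              ≡⟨ ℤ.*-identityˡ _ ⟩
        χ (τ h)                   ≡⟨ sym (ℤ.+-identityʳ _) ⟩
        χ (τ h) - 0ℤ              ≡⟨ cong (λ z → χ (τ h) - z) (sym (δ-≢ h≢0)) ⟩
        χ (τ h) - δ h 0F          ∎
        where
        h[h+d]≡h²τh : h ⊗ (h ⊕ d) ≡ h ⊗ h ⊗ τ h
        h[h+d]≡h²τh = begin
          h ⊗ (h ⊕ d)                            ≡⟨ distribˡ h h d ⟩
          h ⊗ h ⊕ h ⊗ d
            ≡⟨ cong₂ _⊕_ (sym (*-identityʳ _)) (sym (trans (cong (h ⊗ d ⊗_) (inv-inverseʳ h≢0)) (*-identityʳ _))) ⟩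
          h ⊗ h ⊗ 1F ⊕ h ⊗ d ⊗ (h ⊗ inv h)
            ≡⟨ solve 4 (λ h d i o → h :* h :* o :+ h :* d :* (h :* i) := h :* h :* (o :+ d :* i)) refl h d (inv h) 1F ⟩
          h ⊗ h ⊗ τ h                            ∎

  ∑-χ-reflect : ∀ a → ∑ (λ g → χ (a ⊝ g)) ≡ 0ℤ
  ∑-χ-reflect a = trans (∑-reflect a χ) ∑-χ

  ∑-χ-χ : ∀ {a b} → a ≢ b → ∑ (λ g → χ (a ⊝ g) * χ (b ⊝ g)) ≡ -1ℤ
  ∑-χ-χ {a} {b} a≢b = begin
    ∑ (λ g → χ (a ⊝ g) * χ (b ⊝ g))          ≡⟨ ∑-cong (λ g → cong (λ z → χ (a ⊝ g) * χ z) (b-g≡a-g+b-a g)) ⟩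
    ∑ (λ g → χ (a ⊝ g) * χ (a ⊝ g ⊕ (b ⊝ a))) ≡⟨ ∑-reflect a (λ h → χ h * χ (h ⊕ (b ⊝ a))) ⟩
    ∑ (λ h → χ h * χ (h ⊕ (b ⊝ a)))           ≡⟨ ∑-χ-χ-shift (≢⇒⊝≢0 (λ b≡a → a≢b (sym b≡a))) ⟩
    -1ℤ                                       ∎
    where
    b-g≡a-g+b-a : ∀ g → b ⊝ g ≡ a ⊝ g ⊕ (b ⊝ a)
    b-g≡a-g+b-a g = solve 3 (λ a b g → b :- g := a :- g :+ (b :- a)) refl a b g

  ∑-modify₃ : ∀ (f h : Carrier → ℤ) {a b c} → a ≢ b → a ≢ c → b ≢ c →
    (∀ x → x ≢ a → x ≢ b → x ≢ c → f x ≡ h x) → h a ≡ 0ℤ → h b ≡ 0ℤ → h c ≡ 0ℤ →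
    ∑ f ≡ ∑ h + f a + f b + f c
  ∑-modify₃ f h {a} {b} {c} a≢b a≢c b≢c f≡h ha hb hc = begin
    ∑ f                                                          ≡⟨ ∑-cong split ⟩
    ∑ (λ x → h x + δ x a * f a + δ x b * f b + δ x c * f c)     ≡⟨ ∑-+₄ h (λ x → δ x a * f a) (λ x → δ x b * f b) (λ x → δ x c * f c) ⟩
    ∑ h + ∑ (λ x → δ x a * f a) + ∑ (λ x → δ x b * f b) + ∑ (λ x → δ x c * f c)
      ≡⟨ cong₂ _+_ (cong₂ _+_ (cong (_+_ (∑ h)) (∑-pick (λ _ → f a) a)) (∑-pick (λ _ → f b) b)) (∑-pick (λ _ → f c) c) ⟩
    ∑ h + f a + f b + f c                                        ∎
    where
    at-first : ∀ y u v → y ≡ 0ℤ + 1ℤ * y + 0ℤ * u + 0ℤ * v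
    at-first = solve-∀
    at-second : ∀ y u v → y ≡ 0ℤ + 0ℤ * u + 1ℤ * y + 0ℤ * v
    at-second = solve-∀
    at-third : ∀ y u v → y ≡ 0ℤ + 0ℤ * u + 0ℤ * v + 1ℤ * y
    at-third = solve-∀
    elsewhere : ∀ y u v w → y ≡ y + 0ℤ * u + 0ℤ * v + 0ℤ * w
    elsewhere = solve-∀

    split : ∀ x → f x ≡ h x + δ x a * f a + δ x b * f b + δ x c * f c
    split x with x ≟F a | x ≟F b | x ≟F c
    ... | yes refl | yes refl | _ = ⊥-elim (a≢b refl)
    ... | yes refl | _ | yes refl = ⊥-elim (a≢c refl)
    ... | _ | yes refl | yes refl = ⊥-elim (b≢c refl)
    ... | yes refl | no _ | no _ rewrite ha = at-first (f x) (f b) (f c)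
    ... | no _ | yes refl | no _ rewrite hb = at-second (f x) (f a) (f c)
    ... | no _ | no _ | yes refl rewrite hc = at-third (f x) (f a) (f b)
    ... | no x≢a | no x≢b | no x≢c = trans (f≡h x x≢a x≢b x≢c) (elsewhere (h x) (f a) (f b) (f c))

-- Sign patterns of three points

-- The normal form of `and (map (λ j → B (S j)) (allFin 3))` in blocksContaining.
contains₃ : {A : Set} → (A → Bool) → A → A → A → Bool
contains₃ B a b c = B a ∧ (B b ∧ (B c ∧ true))

contains₃-≡false : ∀ {A : Set} (B : A → Bool) {a b c} →
  B a ≡ false ⊎ B b ≡ false ⊎ B c ≡ false → contains₃ B a b c ≡ false
contains₃-≡false B {a} {b} {c} some-false with B a | B b | B c
... | false | _ | _ = refl
... | true | false | _ = refl
... | true | true | false = refl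
... | true | true | true with some-false
...   | inj₁ ()
...   | inj₂ (inj₁ ())
...   | inj₂ (inj₂ ())

agreement-sgn : ∀ p r s → + 4 * ([ p ∧ (r ∧ (s ∧ true)) ] + [ not p ∧ (not r ∧ (not s ∧ true)) ]) ≡
                 1ℤ + sgn p * sgn r + sgn r * sgn s + sgn p * sgn s
agreement-sgn true  true  true  = refl
agreement-sgn true  true  false = refl
agreement-sgn true  false true  = refl
agreement-sgn true  false false = refl
agreement-sgn false true  true  = refl
agreement-sgn false true  false = refl
agreement-sgn false false true  = refl
agreement-sgn false false false = refl

triangle-form : ℤ → ℤ → ℤ → ℤ
triangle-form x y z = x * y + - x * z + - y * - z

triangle-form-sgn : ∀ p r s → triangle-form (sgn p) (sgn r) (sgn s) ≡ 1ℤ ⊎ triangle-form (sgn p) (sgn r) (sgn s) ≡ -[1+ 2 ]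
triangle-form-sgn true  true  true  = inj₁ refl
triangle-form-sgn true  true  false = inj₁ refl
triangle-form-sgn true  false true  = inj₂ refl
triangle-form-sgn true  false false = inj₁ refl
triangle-form-sgn false true  true  = inj₁ refl
triangle-form-sgn false true  false = inj₂ refl
triangle-form-sgn false false true  = inj₁ refl
triangle-form-sgn false false false = inj₁ refl

sign-pattern : ∀ h p r → (1ℤ + sgn p) * (1ℤ + sgn h * sgn r) - 0ℤ * (1ℤ + sgn h) ≢ 0ℤ → sgn p ≡ 1ℤ × sgn r ≡ sgn h
sign-pattern true  true  true  _ = refl , refl
sign-pattern false true  false _ = refl , refl
sign-pattern true  true  false w≢0 = ⊥-elim (w≢0 refl)
sign-pattern false true  true  w≢0 = ⊥-elim (w≢0 refl)
sign-pattern _     false _     w≢0 = ⊥-elim (w≢0 refl)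

triple : {A : Set} → A → A → A → Fin 3 → A
triple a b c zero = a
triple a b c (suc zero) = b
triple a b c (suc (suc zero)) = c

triple-injective : ∀ {A : Set} {a b c : A} → a ≢ b → a ≢ c → b ≢ c → Injective _≡_ _≡_ (triple a b c)
triple-injective a≢b a≢c b≢c {zero} {zero} _ = refl
triple-injective a≢b a≢c b≢c {zero} {suc zero} a≡b = ⊥-elim (a≢b a≡b)
triple-injective a≢b a≢c b≢c {zero} {suc (suc zero)} a≡c = ⊥-elim (a≢c a≡c)
triple-injective a≢b a≢c b≢c {suc zero} {zero} b≡a = ⊥-elim (a≢b (sym b≡a))
triple-injective a≢b a≢c b≢c {suc zero} {suc zero} _ = refl
triple-injective a≢b a≢c b≢c {suc zero} {suc (suc zero)} b≡c = ⊥-elim (b≢c b≡c)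
triple-injective a≢b a≢c b≢c {suc (suc zero)} {zero} c≡a = ⊥-elim (a≢c (sym c≡a))
triple-injective a≢b a≢c b≢c {suc (suc zero)} {suc zero} c≡b = ⊥-elim (b≢c (sym c≡b))
triple-injective a≢b a≢c b≢c {suc (suc zero)} {suc (suc zero)} _ = refl

injective⇒distinct₃ : ∀ {A : Set} {S : Fin 3 → A} → Injective _≡_ _≡_ S →
  S zero ≢ S (suc zero) × S zero ≢ S (suc (suc zero)) × S (suc zero) ≢ S (suc (suc zero))
injective⇒distinct₃ S-injective =
  (λ e → case S-injective e of λ ()) , (λ e → case S-injective e of λ ()) , (λ e → case S-injective e of λ ())

7+4l≡1+2[3+2l] : ∀ l → 7 ℕ.+ 4 ℕ.* l ≡ ℕ.suc (2 ℕ.* (3 ℕ.+ 2 ℕ.* l))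
7+4l≡1+2[3+2l] = ℕ-solve-∀

module ThreeModFour {q : ℕ} (F : FiniteField q) (l : ℕ) (q≡7+4l : q ≡ 7 ℕ.+ 4 ℕ.* l) where
  open OddOrder F (3 ℕ.+ 2 ℕ.* l) (trans q≡7+4l (7+4l≡1+2[3+2l] l)) public
  open ≡-Reasoning

  ⊖1-nonsquare : ¬ IsSquare (⊖ 1F)
  ⊖1-nonsquare ⊖1-square =
    let n , ∑inD0≡2n = ∑-involution-even ⊖_ inD0 -‿involutive inD0-⊖ (λ x x∈D0 ⊖x≡x → x≢⊖x (proj₁ (inD0-sound x∈D0)) (sym ⊖x≡x))
    in ℕ.even≢odd n (ℕ.suc l) (ℤ.+-injective (trans (sym ∑inD0≡2n) (trans ∑-inD0 (cong +_ (3+2l≡1+2[1+l] l)))))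
    where
    3+2l≡1+2[1+l] : ∀ n → 3 ℕ.+ 2 ℕ.* n ≡ ℕ.suc (2 ℕ.* ℕ.suc n)
    3+2l≡1+2[1+l] = ℕ-solve-∀

    inD0-⊖ : ∀ x → inD0 (⊖ x) ≡ inD0 x
    inD0-⊖ x with residue x
    ... | zero x≡0 = trans (inD0-zero (trans (cong ⊖_ x≡0) -0#≈0#)) (sym (inD0-zero x≡0))
    ... | square x≢0 s =
      trans (inD0-square (⊖-≢0 x≢0) (subst IsSquare (sym (⊖-as-⊗ x)) (square-⊗ ⊖1-square s))) (sym (inD0-square x≢0 s))
    ... | nonsquare x≢0 ¬s = trans (inD0-nonsquare ¬⊖s) (sym (inD0-nonsquare ¬s))
      where
      ¬⊖s : ¬ IsSquare (⊖ x)
      ¬⊖s ⊖s = ¬s (subst IsSquare (trans (sym (⊖-as-⊗ (⊖ x))) (-‿involutive x)) (square-⊗ ⊖1-square ⊖s))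

  χ-⊖1 : χ (⊖ 1F) ≡ -1ℤ
  χ-⊖1 = χ-nonsquare (⊖-≢0 1≢0) ⊖1-nonsquare

  χ-antisym : ∀ a b → χ (a ⊝ b) ≡ - χ (b ⊝ a)
  χ-antisym a b = begin
    χ (a ⊝ b)              ≡⟨ cong χ (trans (solve 2 (λ a b → a :- b := :- (b :- a)) refl a b) (⊖-as-⊗ (b ⊝ a))) ⟩
    χ (⊖ 1F ⊗ (b ⊝ a))     ≡⟨ χ-⊗ (⊖ 1F) (b ⊝ a) ⟩
    χ (⊖ 1F) * χ (b ⊝ a)   ≡⟨ cong (_* χ (b ⊝ a)) χ-⊖1 ⟩
    -1ℤ * χ (b ⊝ a)        ≡⟨ ℤ.-1*i≡-i _ ⟩
    - χ (b ⊝ a)            ∎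

  +q≡4l+1+6 : + q ≡ + 4 * + l + 1ℤ + + 6
  +q≡4l+1+6 = begin
    + q                   ≡⟨ cong +_ (trans q≡7+4l (ℕ.+-comm 7 (4 ℕ.* l))) ⟩
    + (4 ℕ.* l) + + 7     ≡⟨ cong (_+ + 7) (ℤ.pos-* 4 l) ⟩
    + 4 * + l + + 7       ≡⟨ sym (ℤ.+-assoc (+ 4 * + l) 1ℤ (+ 6)) ⟩
    + 4 * + l + 1ℤ + + 6  ∎

  +q≡4[l+1]-3+6 : + q ≡ + 4 * + ℕ.suc l + -[1+ 2 ] + + 6
  +q≡4[l+1]-3+6 = trans +q≡4l+1+6 (shift (+ l))
    where
    shift : ∀ x → + 4 * x + 1ℤ + + 6 ≡ + 4 * (1ℤ + x) + -[1+ 2 ] + + 6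
    shift = solve-∀

  cancel-4 : ∀ x y t → + 4 * x + t + + 6 ≡ + 4 * y + t + + 6 → x ≡ y
  cancel-4 x y t e = ℤ.*-cancelˡ-≡ (+ 4) x y (∙-cancelʳ t _ _ (∙-cancelʳ (+ 6) _ _ e))

  blocksThrough : Carrier → Carrier → Carrier → ℤ
  blocksThrough a b c =
    ∑ (λ g → [ contains₃ (translate inD0 g) a b c ] + [ contains₃ (translate inD1 g) a b c ])

  triangle : Carrier → Carrier → Carrier → ℤ
  triangle a b c = χ (b ⊝ a) * χ (c ⊝ a) + χ (a ⊝ b) * χ (c ⊝ b) + χ (a ⊝ c) * χ (b ⊝ c)

  triangle-≡ : ∀ a b c → triangle a b c ≡ triangle-form (χ (b ⊝ a)) (χ (c ⊝ a)) (χ (c ⊝ b))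
  triangle-≡ a b c = cong₂ (λ u v → χ (b ⊝ a) * χ (c ⊝ a) + u * χ (c ⊝ b) + v)
                           (χ-antisym a b) (cong₂ _*_ (χ-antisym a c) (χ-antisym b c))

  χ-self : ∀ a → χ (a ⊝ a) ≡ 0ℤ
  χ-self a = χ-zero (-‿inverseʳ a)

  module _ {a b c : Carrier} (a≢b : a ≢ b) (a≢c : a ≢ c) (b≢c : b ≢ c) where

    triangle-values : triangle a b c ≡ 1ℤ ⊎ triangle a b c ≡ -[1+ 2 ]
    triangle-values = subst (λ t → t ≡ 1ℤ ⊎ t ≡ -[1+ 2 ]) (sym triangle≡sgn)
                            (triangle-form-sgn (inD0 (b ⊝ a)) (inD0 (c ⊝ a)) (inD0 (c ⊝ b)))
      where
      triangle≡sgn : triangle a b c ≡ triangle-form (sgn (inD0 (b ⊝ a))) (sgn (inD0 (c ⊝ a))) (sgn (inD0 (c ⊝ b)))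
      triangle≡sgn = begin
        triangle a b c
          ≡⟨ triangle-≡ a b c ⟩
        triangle-form (χ (b ⊝ a)) (χ (c ⊝ a)) (χ (c ⊝ b))
          ≡⟨ cong₂ (λ x y → triangle-form x y (χ (c ⊝ b))) (χ≡sgn-inD0 (≢⇒⊝≢0 (≢-sym a≢b))) (χ≡sgn-inD0 (≢⇒⊝≢0 (≢-sym a≢c))) ⟩
        triangle-form (sgn (inD0 (b ⊝ a))) (sgn (inD0 (c ⊝ a))) (χ (c ⊝ b))
          ≡⟨ cong (triangle-form (sgn (inD0 (b ⊝ a))) (sgn (inD0 (c ⊝ a)))) (χ≡sgn-inD0 (≢⇒⊝≢0 (≢-sym b≢c))) ⟩
        triangle-form (sgn (inD0 (b ⊝ a))) (sgn (inD0 (c ⊝ a))) (sgn (inD0 (c ⊝ b))) ∎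

    private
      agreement correlation : Carrier → ℤ
      agreement g = [ contains₃ (translate inD0 g) a b c ] + [ contains₃ (translate inD1 g) a b c ]
      correlation g = 1ℤ + χ (a ⊝ g) * χ (b ⊝ g) + χ (b ⊝ g) * χ (c ⊝ g) + χ (a ⊝ g) * χ (c ⊝ g)

      correlation≡4*agreement : ∀ g → g ≢ a → g ≢ b → g ≢ c → correlation g ≡ + 4 * agreement g
      correlation≡4*agreement g g≢a g≢b g≢c
        rewrite inD1≡not-inD0 (≢⇒⊝≢0 (≢-sym g≢a)) | inD1≡not-inD0 (≢⇒⊝≢0 (≢-sym g≢b))
              | inD1≡not-inD0 (≢⇒⊝≢0 (≢-sym g≢c))
        = sym (agreement-sgn (inD0 (a ⊝ g)) (inD0 (b ⊝ g)) (inD0 (c ⊝ g)))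

      vanishes : ∀ (B : Carrier → Bool) → B 0F ≡ false →
                 ∀ g → g ≡ a ⊎ g ≡ b ⊎ g ≡ c → contains₃ (translate B g) a b c ≡ false
      vanishes B B0≡false g (inj₁ refl) =
        contains₃-≡false (translate B g) (inj₁ (trans (cong B (-‿inverseʳ g)) B0≡false))
      vanishes B B0≡false g (inj₂ (inj₁ refl)) =
        contains₃-≡false (translate B g) (inj₂ (inj₁ (trans (cong B (-‿inverseʳ g)) B0≡false)))
      vanishes B B0≡false g (inj₂ (inj₂ refl)) =
        contains₃-≡false (translate B g) (inj₂ (inj₂ (trans (cong B (-‿inverseʳ g)) B0≡false)))

      agreement-at : ∀ g → g ≡ a ⊎ g ≡ b ⊎ g ≡ c → + 4 * agreement g ≡ 0ℤ
      agreement-at g g∈abc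
        rewrite vanishes inD0 (inD0-zero refl) g g∈abc | vanishes inD1 (inD1-zero refl) g g∈abc
        = refl

      correlation-at-a : correlation a ≡ 1ℤ + χ (b ⊝ a) * χ (c ⊝ a)
      correlation-at-a rewrite χ-self a = at (χ (b ⊝ a)) (χ (c ⊝ a))
        where
        at : ∀ y z → 1ℤ + 0ℤ * y + y * z + 0ℤ * z ≡ 1ℤ + y * z
        at = solve-∀

      correlation-at-b : correlation b ≡ 1ℤ + χ (a ⊝ b) * χ (c ⊝ b)
      correlation-at-b rewrite χ-self b = at (χ (a ⊝ b)) (χ (c ⊝ b))
        where
        at : ∀ x z → 1ℤ + x * 0ℤ + 0ℤ * z + x * z ≡ 1ℤ + x * z
        at = solve-∀

      correlation-at-c : correlation c ≡ 1ℤ + χ (a ⊝ c) * χ (b ⊝ c)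
      correlation-at-c rewrite χ-self c = at (χ (a ⊝ c)) (χ (b ⊝ c))
        where
        at : ∀ x y → 1ℤ + x * y + y * 0ℤ + x * 0ℤ ≡ 1ℤ + x * y
        at = solve-∀

      ∑-correlation : ∑ correlation ≡ + q * 1ℤ + -1ℤ + -1ℤ + -1ℤ
      ∑-correlation = begin
        ∑ correlation
          ≡⟨ ∑-+₄ (λ _ → 1ℤ) (λ g → χ (a ⊝ g) * χ (b ⊝ g)) (λ g → χ (b ⊝ g) * χ (c ⊝ g)) (λ g → χ (a ⊝ g) * χ (c ⊝ g)) ⟩
        ∑ (λ _ → 1ℤ) + ∑ (λ g → χ (a ⊝ g) * χ (b ⊝ g)) + ∑ (λ g → χ (b ⊝ g) * χ (c ⊝ g)) + ∑ (λ g → χ (a ⊝ g) * χ (c ⊝ g))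
          ≡⟨ cong₂ _+_ (cong₂ _+_ (cong₂ _+_ (∑-const 1ℤ) (∑-χ-χ a≢b)) (∑-χ-χ b≢c)) (∑-χ-χ a≢c) ⟩
        + q * 1ℤ + -1ℤ + -1ℤ + -1ℤ  ∎

    -- Double counting: ∑ correlation is q - 3 by ∑-χ-χ, and it is 4 for each block through
    -- a, b, c plus the values 1 + χ (b ⊝ a) * χ (c ⊝ a), … of correlation at g = a, b, c.
    blocksThrough-triangle : + 4 * blocksThrough a b c + triangle a b c + + 6 ≡ + q
    blocksThrough-triangle = begin
      + 4 * blocksThrough a b c + triangle a b c + + 6
        ≡⟨ regroup (blocksThrough a b c) (χ (b ⊝ a) * χ (c ⊝ a)) (χ (a ⊝ b) * χ (c ⊝ b)) (χ (a ⊝ c) * χ (b ⊝ c)) ⟩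
      + 4 * blocksThrough a b c + (1ℤ + χ (b ⊝ a) * χ (c ⊝ a)) + (1ℤ + χ (a ⊝ b) * χ (c ⊝ b)) + (1ℤ + χ (a ⊝ c) * χ (b ⊝ c)) + + 3
        ≡⟨ cong (_+ + 3) (cong₂ _+_ (cong₂ _+_ (cong₂ _+_ (sym (∑-*ˡ (+ 4) agreement))
             (sym correlation-at-a)) (sym correlation-at-b)) (sym correlation-at-c)) ⟩
      ∑ (λ g → + 4 * agreement g) + correlation a + correlation b + correlation c + + 3
        ≡⟨ cong (_+ + 3) (sym (∑-modify₃ correlation (λ g → + 4 * agreement g) a≢b a≢c b≢c correlation≡4*agreement
             (agreement-at a (inj₁ refl)) (agreement-at b (inj₂ (inj₁ refl))) (agreement-at c (inj₂ (inj₂ refl))))) ⟩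
      ∑ correlation + + 3                     ≡⟨ cong (_+ + 3) ∑-correlation ⟩
      + q * 1ℤ + -1ℤ + -1ℤ + -1ℤ + + 3        ≡⟨ cancel (+ q) ⟩
      + q                                     ∎
      where
      regroup : ∀ n x y z → + 4 * n + (x + y + z) + + 6 ≡ + 4 * n + (1ℤ + x) + (1ℤ + y) + (1ℤ + z) + + 3
      regroup = solve-∀
      cancel : ∀ Q → Q * 1ℤ + -1ℤ + -1ℤ + -1ℤ + + 3 ≡ Q
      cancel = solve-∀

    blocksThrough-1 : triangle a b c ≡ 1ℤ → blocksThrough a b c ≡ + l
    blocksThrough-1 t≡1 = cancel-4 (blocksThrough a b c) (+ l) 1ℤ
      (trans (cong (λ t → + 4 * blocksThrough a b c + t + + 6) (sym t≡1)) (trans blocksThrough-triangle +q≡4l+1+6))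

    blocksThrough-3 : triangle a b c ≡ -[1+ 2 ] → blocksThrough a b c ≡ + ℕ.suc l
    blocksThrough-3 t≡-3 = cancel-4 (blocksThrough a b c) (+ ℕ.suc l) -[1+ 2 ]
      (trans (cong (λ t → + 4 * blocksThrough a b c + t + + 6) (sym t≡-3)) (trans blocksThrough-triangle +q≡4[l+1]-3+6))

  0-1≡⊖1 : 0F ⊝ 1F ≡ ⊖ 1F
  0-1≡⊖1 = +-identityˡ (⊖ 1F)

  1-0≡1 : 1F ⊝ 0F ≡ 1F
  1-0≡1 = solve 1 (λ o → o :- con 0ℤ := o) refl 1F
    where open Algebra.Solver.Ring using (con)

  ∑-pattern-weight : ∀ e → ∑ (λ g → (1ℤ + χ (0F ⊝ g)) * (1ℤ + e * χ (1F ⊝ g)) - δ g 0F * (1ℤ + e))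
                         ≡ + q * 1ℤ + 0ℤ + e * 0ℤ + e * -1ℤ + - (1ℤ + e)
  ∑-pattern-weight e = begin
    ∑ (λ g → (1ℤ + X g) * (1ℤ + e * Y g) - δ g 0F * (1ℤ + e))
      ≡⟨ ∑-cong (λ g → expand (X g) (Y g) e (δ g 0F)) ⟩
    ∑ (λ g → 1ℤ + X g + e * Y g + e * (X g * Y g) + - (δ g 0F * (1ℤ + e)))
      ≡⟨ ∑-+ (λ g → 1ℤ + X g + e * Y g + e * (X g * Y g)) (λ g → - (δ g 0F * (1ℤ + e))) ⟩
    ∑ (λ g → 1ℤ + X g + e * Y g + e * (X g * Y g)) + ∑ (λ g → - (δ g 0F * (1ℤ + e)))
      ≡⟨ cong₂ _+_ (∑-+₄ (λ _ → 1ℤ) X (λ g → e * Y g) (λ g → e * (X g * Y g)))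
                   (trans (∑-neg (λ g → δ g 0F * (1ℤ + e))) (cong -_ (∑-pick (λ _ → 1ℤ + e) 0F))) ⟩
    ∑ (λ _ → 1ℤ) + ∑ X + ∑ (λ g → e * Y g) + ∑ (λ g → e * (X g * Y g)) + - (1ℤ + e)
      ≡⟨ cong (_+ - (1ℤ + e)) (cong₂ _+_ (cong₂ _+_ (cong₂ _+_ (∑-const 1ℤ) (∑-χ-reflect 0F))
           (trans (∑-*ˡ e Y) (cong (e *_) (∑-χ-reflect 1F))))
           (trans (∑-*ˡ e (λ g → X g * Y g)) (cong (e *_) (∑-χ-χ 0≢1)))) ⟩
    + q * 1ℤ + 0ℤ + e * 0ℤ + e * -1ℤ + - (1ℤ + e)  ∎
    where
    X Y : Carrier → ℤ
    X g = χ (0F ⊝ g)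
    Y g = χ (1F ⊝ g)

    expand : ∀ x y e d → (1ℤ + x) * (1ℤ + e * y) - d * (1ℤ + e) ≡ 1ℤ + x + e * y + e * (x * y) + - (d * (1ℤ + e))
    expand = solve-∀

  χ-pattern : ∀ h → ∃ λ g → g ≢ 0F × g ≢ 1F × χ (0F ⊝ g) ≡ 1ℤ × χ (1F ⊝ g) ≡ sgn h
  χ-pattern h = pattern-at (∑-witness weight ∑-weight≢0)
    where
    -- For g ∉ {0F , 1F}, weight g is 4 when χ (0F ⊝ g) ≡ 1ℤ and χ (1F ⊝ g) ≡ sgn h, and 0 otherwise;
    -- the δ-term cancels the value at g = 0F.
    W : ℤ → ℤ → ℤ → ℤ
    W x y d = (1ℤ + x) * (1ℤ + sgn h * y) - d * (1ℤ + sgn h)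

    weight : Carrier → ℤ
    weight g = W (χ (0F ⊝ g)) (χ (1F ⊝ g)) (δ g 0F)

    total≢0 : ∀ h → + (7 ℕ.+ 4 ℕ.* l) * 1ℤ + 0ℤ + sgn h * 0ℤ + sgn h * -1ℤ + - (1ℤ + sgn h) ≢ 0ℤ
    total≢0 true ()
    total≢0 false ()

    ∑-weight≢0 : ∑ weight ≢ 0ℤ
    ∑-weight≢0 ∑≡0 = total≢0 h (subst (λ n → + n * 1ℤ + 0ℤ + sgn h * 0ℤ + sgn h * -1ℤ + - (1ℤ + sgn h) ≡ 0ℤ)
                                     q≡7+4l (trans (sym (∑-pattern-weight (sgn h))) ∑≡0))

    pattern-at : (∃ λ g → weight g ≢ 0ℤ) → ∃ λ g → g ≢ 0F × g ≢ 1F × χ (0F ⊝ g) ≡ 1ℤ × χ (1F ⊝ g) ≡ sgn h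
    pattern-at (g , weight≢0) = g , g≢0 , g≢1 , signs
      where
      g≢0 : g ≢ 0F
      g≢0 g≡0 = weight≢0 (begin
        W (χ (0F ⊝ g)) (χ (1F ⊝ g)) (δ g 0F)
          ≡⟨ cong₂ (W (χ (0F ⊝ g))) (cong (λ x → χ (1F ⊝ x)) g≡0) (δ-≡ g≡0) ⟩
        W (χ (0F ⊝ g)) (χ (1F ⊝ 0F)) 1ℤ
          ≡⟨ cong₂ (λ x y → W x y 1ℤ) (χ-zero (trans (cong (0F ⊝_) g≡0) (-‿inverseʳ 0F))) (trans (cong χ 1-0≡1) χ-1) ⟩
        W 0ℤ 1ℤ 1ℤ  ≡⟨ W-at-0 (sgn h) ⟩
        0ℤ          ∎)
        where
        W-at-0 : ∀ e → (1ℤ + 0ℤ) * (1ℤ + e * 1ℤ) - 1ℤ * (1ℤ + e) ≡ 0ℤ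
        W-at-0 = solve-∀

      g≢1 : g ≢ 1F
      g≢1 g≡1 = weight≢0 (cong₂ (λ x d → W x (χ (1F ⊝ g)) d)
        (trans (cong (λ x → χ (0F ⊝ x)) g≡1) (trans (cong χ 0-1≡⊖1) χ-⊖1)) (δ-≢ (λ g≡0 → 1≢0 (trans (sym g≡1) g≡0))))

      signs : χ (0F ⊝ g) ≡ 1ℤ × χ (1F ⊝ g) ≡ sgn h
      signs =
        let X≡1 , Y≡sgn-h = sign-pattern h (inD0 (0F ⊝ g)) (inD0 (1F ⊝ g)) λ W≡0 → weight≢0 (begin
              W (χ (0F ⊝ g)) (χ (1F ⊝ g)) (δ g 0F)          ≡⟨ cong₂ (λ x y → W x y (δ g 0F)) χ-at-0 χ-at-1 ⟩
              W (sgn (inD0 (0F ⊝ g))) (sgn (inD0 (1F ⊝ g))) (δ g 0F) ≡⟨ cong (W (sgn (inD0 (0F ⊝ g))) (sgn (inD0 (1F ⊝ g)))) (δ-≢ g≢0) ⟩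
              W (sgn (inD0 (0F ⊝ g))) (sgn (inD0 (1F ⊝ g))) 0ℤ       ≡⟨ W≡0 ⟩
              0ℤ                                             ∎)
        in trans χ-at-0 X≡1 , trans χ-at-1 Y≡sgn-h
        where
        χ-at-0 : χ (0F ⊝ g) ≡ sgn (inD0 (0F ⊝ g))
        χ-at-0 = χ≡sgn-inD0 (≢⇒⊝≢0 (≢-sym g≢0))
        χ-at-1 : χ (1F ⊝ g) ≡ sgn (inD0 (1F ⊝ g))
        χ-at-1 = χ≡sgn-inD0 (≢⇒⊝≢0 (≢-sym g≢1))

  triangle-pattern : ∀ {g} h → χ (0F ⊝ g) ≡ 1ℤ → χ (1F ⊝ g) ≡ sgn h → triangle g 0F 1F ≡ triangle-form 1ℤ (sgn h) 1ℤ
  triangle-pattern {g} h X≡1 Y≡sgn-h = begin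
    triangle g 0F 1F                                     ≡⟨ triangle-≡ g 0F 1F ⟩
    triangle-form (χ (0F ⊝ g)) (χ (1F ⊝ g)) (χ (1F ⊝ 0F)) ≡⟨ cong₂ (λ x y → triangle-form x y (χ (1F ⊝ 0F))) X≡1 Y≡sgn-h ⟩
    triangle-form 1ℤ (sgn h) (χ (1F ⊝ 0F))               ≡⟨ cong (triangle-form 1ℤ (sgn h)) Z≡1 ⟩
    triangle-form 1ℤ (sgn h) 1ℤ                          ∎
    where
    Z≡1 : χ (1F ⊝ 0F) ≡ 1ℤ
    Z≡1 = trans (cong χ 1-0≡1) χ-1

  blockSize-translate : ∀ C g → + blockSize cyclotomicDesign (translate C g) ≡ ∑ (λ y → [ C y ])
  blockSize-translate C g = trans (length-filter-elements (translate C g)) (∑-translate g (λ y → [ C y ]))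

  blockSizes : ∀ B → B ∈ blocks cyclotomicDesign → blockSize cyclotomicDesign B ≡ 3 ℕ.+ 2 ℕ.* l
  blockSizes B B∈blocks with ∈-++⁻ (Dev inD0) B∈blocks
  ... | inj₁ B∈Dev-D0 with _ , _ , refl ← ∈-map⁻ (translate inD0) B∈Dev-D0 = ℤ.+-injective (trans (blockSize-translate inD0 _) ∑-inD0)
  ... | inj₂ B∈Dev-D1 with _ , _ , refl ← ∈-map⁻ (translate inD1) B∈Dev-D1 = ℤ.+-injective (trans (blockSize-translate inD1 _) ∑-inD1)

  +blocksContaining : ∀ (S : Fin 3 → Carrier) →
    + blocksContaining cyclotomicDesign S ≡ blocksThrough (S zero) (S (suc zero)) (S (suc (suc zero)))
  +blocksContaining S = begin
    + length (filter P? (Dev inD0 ++ Dev inD1))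
      ≡⟨ cong (λ ys → + length ys) (filter-++ P? (Dev inD0) (Dev inD1)) ⟩
    + length (filter P? (Dev inD0) ++ filter P? (Dev inD1))
      ≡⟨ cong +_ (length-++ (filter P? (Dev inD0))) ⟩
    + length (filter P? (Dev inD0)) + + length (filter P? (Dev inD1))
      ≡⟨ cong₂ _+_ (length-filter-map-elements contains-S (translate inD0)) (length-filter-map-elements contains-S (translate inD1)) ⟩
    ∑ (λ g → [ contains-S (translate inD0 g) ]) + ∑ (λ g → [ contains-S (translate inD1 g) ])
      ≡⟨ sym (∑-+ (λ g → [ contains-S (translate inD0 g) ]) (λ g → [ contains-S (translate inD1 g) ])) ⟩
    blocksThrough (S zero) (S (suc zero)) (S (suc (suc zero))) ∎
    where
    contains-S : (Carrier → Bool) → Bool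
    contains-S B = contains₃ B (S zero) (S (suc zero)) (S (suc (suc zero)))
    P? : ∀ B → Dec (contains-S B ≡ true)
    P? B = contains-S B Bool.≟ true

  blocksContaining-1 : ∀ (S : Fin 3 → Carrier) → Injective _≡_ _≡_ S →
    triangle (S zero) (S (suc zero)) (S (suc (suc zero))) ≡ 1ℤ → blocksContaining cyclotomicDesign S ≡ l
  blocksContaining-1 S S-injective t≡1 =
    let a≢b , a≢c , b≢c = injective⇒distinct₃ S-injective
    in ℤ.+-injective (trans (+blocksContaining S) (blocksThrough-1 a≢b a≢c b≢c t≡1))

  blocksContaining-3 : ∀ (S : Fin 3 → Carrier) → Injective _≡_ _≡_ S →
    triangle (S zero) (S (suc zero)) (S (suc (suc zero))) ≡ -[1+ 2 ] → blocksContaining cyclotomicDesign S ≡ ℕ.suc l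
  blocksContaining-3 S S-injective t≡-3 =
    let a≢b , a≢c , b≢c = injective⇒distinct₃ S-injective
    in ℤ.+-injective (trans (+blocksContaining S) (blocksThrough-3 a≢b a≢c b≢c t≡-3))

  blocksContaining-values : ∀ (S : Fin 3 → Carrier) → Injective _≡_ _≡_ S →
    blocksContaining cyclotomicDesign S ≡ l ⊎ blocksContaining cyclotomicDesign S ≡ ℕ.suc l
  blocksContaining-values S S-injective =
    let a≢b , a≢c , b≢c = injective⇒distinct₃ S-injective
    in [ inj₁ ∘ blocksContaining-1 S S-injective , inj₂ ∘ blocksContaining-3 S S-injective ]′ (triangle-values a≢b a≢c b≢c)

  triple-with-pattern : ∀ h → Σ (Fin 3 → Carrier) λ S → Injective _≡_ _≡_ S ×
    triangle (S zero) (S (suc zero)) (S (suc (suc zero))) ≡ triangle-form 1ℤ (sgn h) 1ℤ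
  triple-with-pattern h =
    let g , g≢0 , g≢1 , X≡1 , Y≡sgn-h = χ-pattern h
    in triple g 0F 1F , triple-injective g≢0 g≢1 0≢1 , triangle-pattern h X≡1 Y≡sgn-h

  isAdesign : IsAdesign cyclotomicDesign 3 q (3 ℕ.+ 2 ℕ.* l) l
  isAdesign = record
    { numPoints  = refl
    ; blockSizes = blockSizes
    ; eitherVal  = blocksContaining-values
    ; λOccurs    = let S , S-injective , t≡1 = triple-with-pattern true
                   in S , S-injective , blocksContaining-1 S S-injective t≡1
    ; λ+1Occurs  = let S , S-injective , t≡-3 = triple-with-pattern false
                   in S , S-injective , blocksContaining-3 S S-injective t≡-3
    }

%4≡3⇒≡7+4l : ∀ {q} → q % 4 ≡ 3 → 7 ℕ.≤ q → ∃ λ l → q ≡ 7 ℕ.+ 4 ℕ.* l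
%4≡3⇒≡7+4l {q} q%4≡3 7≤q with q / 4 | trans (m≡m%n+[m/n]*n q 4) (cong (ℕ._+ (q / 4) ℕ.* 4) q%4≡3)
... | ℕ.zero | q≡3 with ℕ.s≤s (ℕ.s≤s (ℕ.s≤s ())) ← subst (7 ℕ.≤_) q≡3 7≤q
... | ℕ.suc l | q≡3+[1+l]*4 = l , trans q≡3+[1+l]*4 (3+[1+l]*4≡7+4l l)
  where
  3+[1+l]*4≡7+4l : ∀ n → 3 ℕ.+ ℕ.suc n ℕ.* 4 ≡ 7 ℕ.+ 4 ℕ.* n
  3+[1+l]*4≡7+4l = ℕ-solve-∀

[q∸1]/2 : ∀ {q l} → q ≡ 7 ℕ.+ 4 ℕ.* l → (q ∸ 1) / 2 ≡ 3 ℕ.+ 2 ℕ.* l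
[q∸1]/2 {l = l} refl = trans (cong (_/ 2) (6+4l≡[3+2l]*2 l)) (m*n/n≡m (3 ℕ.+ 2 ℕ.* l) 2)
  where
  6+4l≡[3+2l]*2 : ∀ n → 6 ℕ.+ 4 ℕ.* n ≡ (3 ℕ.+ 2 ℕ.* n) ℕ.* 2
  6+4l≡[3+2l]*2 = ℕ-solve-∀

[q∸7]/4 : ∀ {q l} → q ≡ 7 ℕ.+ 4 ℕ.* l → (q ∸ 7) / 4 ≡ l
[q∸7]/4 {l = l} refl = trans (cong (_/ 4) (ℕ.*-comm 4 l)) (m*n/n≡m l 4)

theorem11 : (q : ℕ) (F : FiniteField q) → q % 4 ≡ 3 → 7 ≤ q →
    IsAdesign (FiniteField.cyclotomicDesign F) 3 q ((q ∸ 1) / 2) ((q ∸ 7) / 4)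
theorem11 q F q%4≡3 7≤q =
  let l , q≡7+4l = %4≡3⇒≡7+4l q%4≡3 7≤q
  in subst₂ (IsAdesign (FiniteField.cyclotomicDesign F) 3 q) (sym ([q∸1]/2 {l = l} q≡7+4l)) (sym ([q∸7]/4 {l = l} q≡7+4l))
       (ThreeModFour.isAdesign F l q≡7+4l)
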